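{- Let $\lambda$ be a strict partition. For any probability distribution $\mu$ on $J(P^{\mathrm{shift}}_\lambda)$ and any box $[i,j]\in P^{\mathrm{shift}}_\lambda$, $$\mathbb{E}(\mu;R^{\mathrm{shift}}_{ij})=1+\sum_{c\in C^{\mathrm{shift}}_{ij}(\lambda)}\mathbb{P}(\nu\sim\mu;\,c\in\nu).$$
   Context: A partition is strict if $\lambda_i>\lambda_{i+1}$ whenever $\lambda_i\neq 0$; $\ell(\lambda)$ is its number of nonzero parts. $P^{\mathrm{shift}}_\lambda$ is the set of boxes $[i,j]$ with $1\le i\le\ell(\lambda)$, $i\le j\le i+\lambda_i-1$, ordered by $[i,j]\le[i',j']$ iff $i\le i'$ and $j\le j'$; its order ideals are identified with strict partitions $\nu\subseteq\lambda$ (row $i$ of $\nu$ is the boxes $[i,j]$, $i\le j\le i+\nu_i-1$). For $I\in J(P)$, $p\in P$: $\mathcal{T}^+_p(I)=1$ if $p\notin I$ and $p$ minimal in $P\setminus I$, else 0; $\mathcal{T}^-_p(I)=1$ if $p\in I$ and $p$ maximal in $I$, else 0. The shifted rook is $$R^{\mathrm{shift}}_{ij}:=\sum_{i'\le i,\,j'\le j}\mathcal{T}^+_{[i',j']}+\sum_{i'\ge i,\,j'\ge j}\mathcal{T}^-_{[i',j']}-\sum_{i'<i,\,j'<j,\,i'<j'}\mathcal{T}^-_{[i',j']}-\sum_{i'>i,\,j'>j,\,i'<j'}\mathcal{T}^+_{[i',j']},$$ all sums over boxes $[i',j']\in P^{\mathrm{shift}}_\lambda$. Outward corners: $C^{\mathrm{shift}}(\lambda)$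 is the set of corners $c_m$ for indices $1\le m\le\ell(\lambda)-1$ with $\lambda_m>\lambda_{m+1}+1$; the corner $c_m$ (a north step followed by an east step on the southeast border of the shifted diagram, in matrix coordinates where box $[i,j]$ has southeast lattice corner $(i,j)$) occurs at the lattice point $(m,\,m+\lambda_{m+1})$. An order ideal $\nu$ contains $c_m$ (written $c_m\in\nu$) iff the boundary lattice path of $\nu$ uses both steps of $c_m$, i.e. iff $\nu_{m+1}=\lambda_{m+1}$ and $\nu_m\ge\lambda_{m+1}+2$. $C^{\mathrm{shift}}_{ij}(\lambda)$ is the set of $c_m\in C^{\mathrm{shift}}(\lambda)$ occurring strictly southeast of the center of box $[i,j]$, i.e. with $m\ge i$ and $m+\lambda_{m+1}\ge j$.
   Formalization: The probability distribution μ on $J(P^{\mathrm{shift}}_\lambda)$ assigns rational rather than real probabilities to the order ideals. -}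

module Defs where

open import Data.Nat as ℕ using (ℕ; zero; suc; _+_; _∸_; _≤_; _<_; _≤ᵇ_; _<ᵇ_; _≡ᵇ_)
open import Data.Bool using (Bool; true; false; _∧_; _∨_; not; if_then_else_)
open import Data.List using (List; []; _∷_; [_]; map; concatMap; filter; length; upTo; foldr)
open import Data.Product using (_×_; _,_; proj₁; proj₂)
open import Data.Integer as ℤ using (ℤ; +_)
open import Data.Rational as ℚ using (ℚ)
open import Relation.Binary.PropositionalEquality using (_≡_)
open import Relation.Nullary.Decidable using (yes; no)
open import Data.Bool using (T)

-- Strict partitions: a list of exactly the NONZERO parts,
-- strictly decreasing (so ℓ(λ) = length λ).

data Strict : List ℕ → Set where
  nil  : Strict []
  one  : ∀ {a} → 0 < a → Strict (a ∷ [])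
  cons : ∀ {a b l} → b < a → Strict (b ∷ l) → Strict (a ∷ b ∷ l)

-- 1-indexed part λ_i  (λ_i = 0 for i = 0 or i > ℓ(λ))
part : List ℕ → ℕ → ℕ
part l zero = 0
part [] (suc i) = 0
part (x ∷ l) (suc zero) = x
part (x ∷ l) (suc (suc i)) = part l (suc i)

ℓ : List ℕ → ℕ
ℓ = length

-- [a .. b] as a list (empty if b < a)
range : ℕ → ℕ → List ℕ
range a b = map (λ k → a + k) (upTo (suc b ∸ a))

Box : Set
Box = ℕ × ℕ

inShapeᵇ : List ℕ → Box → Bool
inShapeᵇ ν (i , j) = (1 ≤ᵇ i) ∧ (i ≤ᵇ j) ∧ (j <ᵇ i + part ν i)

IsBox : List ℕ → ℕ → ℕ → Set
IsBox lam i j = (1 ≤ i) × (i ≤ ℓ lam) × (i ≤ j) × (j < i + part lam i)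

boxes : List ℕ → List Box
boxes lam = concatMap (λ i → map (λ j → (i , j)) (range i (i + part lam i ∸ 1)))
                      (range 1 (ℓ lam))

leᵇ : Box → Box → Bool
leᵇ (i , j) (i' , j') = (i ≤ᵇ i') ∧ (j ≤ᵇ j')

eqᵇ : Box → Box → Bool
eqᵇ (i , j) (i' , j') = (i ≡ᵇ i') ∧ (j ≡ᵇ j')

ltᵇ : Box → Box → Bool
ltᵇ p q = leᵇ p q ∧ not (eqᵇ p q)

-- Order ideals J(P^shift_λ), identified with strict partitions ν ⊆ λ.
-- ν is represented as a list of length ℓ(λ) (padded with zeros) with
-- ν_i ≤ λ_i and ν_i > ν_{i+1} whenever ν_{i+1} ≠ 0.

candidates : List ℕ → List (List ℕ)
candidates [] = [ [] ]
candidates (a ∷ l) = concatMap (λ x → map (x ∷_) (candidates l)) (upTo (suc a))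

strictPaddedᵇ : List ℕ → Bool
strictPaddedᵇ [] = true
strictPaddedᵇ (a ∷ []) = true
strictPaddedᵇ (a ∷ b ∷ l) = ((b ≡ᵇ 0) ∨ (b <ᵇ a)) ∧ strictPaddedᵇ (b ∷ l)

ideals : List ℕ → List (List ℕ)
ideals lam = filter (λ ν → T? (strictPaddedᵇ ν)) (candidates lam)
  where
  open import Relation.Nullary using (Dec)
  open import Data.Bool.Properties using (T?)

allᵇ : List Box → (Box → Bool) → Bool
allᵇ [] f = true
allᵇ (p ∷ ps) f = f p ∧ allᵇ ps f

T⁺ᵇ : List ℕ → List ℕ → Box → Bool
T⁺ᵇ lam ν p = not (inShapeᵇ ν p)
            ∧ allᵇ (boxes lam) (λ q → not (ltᵇ q p) ∨ inShapeᵇ ν q)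

T⁻ᵇ : List ℕ → List ℕ → Box → Bool
T⁻ᵇ lam ν p = inShapeᵇ ν p
            ∧ allᵇ (boxes lam) (λ q → not (ltᵇ p q) ∨ not (inShapeᵇ ν q))

count : List Box → (Box → Bool) → ℕ
count [] f = 0
count (p ∷ ps) f = (if f p then 1 else 0) + count ps f

Rshift : List ℕ → ℕ → ℕ → List ℕ → ℤ
Rshift lam i j ν =
      (+ count P (λ { (i' , j') → (i' ≤ᵇ i) ∧ (j' ≤ᵇ j) ∧ T⁺ᵇ lam ν (i' , j') }))
  ℤ.+ (+ count P (λ { (i' , j') → (i ≤ᵇ i') ∧ (j ≤ᵇ j') ∧ T⁻ᵇ lam ν (i' , j') }))
  ℤ.- (+ count P (λ { (i' , j') → (i' <ᵇ i) ∧ (j' <ᵇ j) ∧ (i' <ᵇ j') ∧ T⁻ᵇ lam ν (i' , j') }))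
  ℤ.- (+ count P (λ { (i' , j') → (i <ᵇ i') ∧ (j <ᵇ j') ∧ (i' <ᵇ j') ∧ T⁺ᵇ lam ν (i' , j') }))
  where P = boxes lam

-- Outward corners c_m (indexed by m), 1 ≤ m ≤ ℓ(λ)-1, λ_m > λ_{m+1}+1,
-- located at lattice point (m, m + λ_{m+1}).

corners : List ℕ → List ℕ
corners lam = filter (λ m → T? (suc (part lam (suc m)) <ᵇ part lam m)) (range 1 (ℓ lam ∸ 1))
  where open import Data.Bool.Properties using (T?)

cornersSE : List ℕ → ℕ → ℕ → List ℕ
cornersSE lam i j =
  filter (λ m → T? ((i ≤ᵇ m) ∧ (j ≤ᵇ m + part lam (suc m)))) (corners lam)
  where open import Data.Bool.Properties using (T?)

cornerInᵇ : List ℕ → ℕ → List ℕ → Bool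
cornerInᵇ lam m ν = (part ν (suc m) ≡ᵇ part lam (suc m))
                  ∧ (suc (suc (part lam (suc m))) ≤ᵇ part ν m)

Σℚ : {A : Set} → List A → (A → ℚ) → ℚ
Σℚ xs f = foldr (λ x acc → f x ℚ.+ acc) ℚ.0ℚ xs

IsDistribution : List ℕ → (List ℕ → ℚ) → Set
IsDistribution lam μ =
  ((ν : List ℕ) → ν Data.List.Membership.Propositional.∈ ideals lam → ℚ.0ℚ ℚ.≤ μ ν)
  × (Σℚ (ideals lam) μ ≡ ℚ.1ℚ)
  where import Data.List.Membership.Propositional

toℚ : ℤ → ℚ
toℚ z = z ℚ./ 1

𝔼 : List ℕ → (List ℕ → ℚ) → (List ℕ → ℤ) → ℚ
𝔼 lam μ f = Σℚ (ideals lam) (λ ν → μ ν ℚ.* toℚ (f ν))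

ℙ : List ℕ → (List ℕ → ℚ) → (List ℕ → Bool) → ℚ
ℙ lam μ Q = Σℚ (ideals lam) (λ ν → if Q ν then μ ν else ℚ.0ℚ)

-- Fix an ideal ν. A toggle T⁺ can only fire at the first box (r , r + ν_r) of a row outside ν, and T⁻
-- only at the last box (r , r + ν_r − 1) inside ν, so each of the four sums defining R_ij is a sum over
-- rows of one indicator per row. Over the rows r ≤ i the north-west terms telescope: two consecutive
-- rows satisfy [r + ν_r ≤ j] + T⁺(row r + 1) = [r + 1 + ν_{r+1} ≤ j] + T⁻(row r). Over the rows r ≥ i the
-- south-east terms telescope likewise, except that a pair of rows leaves one extra unit exactly when
-- it forms an outward corner c_r ∈ ν south-east of [i , j]. What survives is
-- [i + ν_i ≤ j] + [j < i + ν_i] + #{c ∈ C_ij : c ∈ ν} = 1 + #{c ∈ C_ij : c ∈ ν}, and averaging this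
-- pointwise identity against weights of total mass 1 gives the claim.
module Submission where

open import Defs
open import Data.Nat as ℕ using (ℕ; zero; suc; _+_; _∸_; _≤_; _<_; _≤ᵇ_; _<ᵇ_; _≡ᵇ_; z≤n; s≤s; z<s; _≟_; _≤?_)
open import Data.Nat.Properties
open import Data.Bool using (Bool; true; false; _∧_; _∨_; not; if_then_else_; T)
open import Data.Bool.Properties using (T?; ∧-zeroʳ; ∧-identityʳ; ∧-assoc)
open import Data.List using (List; []; _∷_; map; concatMap; filter; upTo; applyUpTo; _++_)
open import Data.List.Properties using (map-applyUpTo)
open import Data.List.Membership.Propositional using (_∈_; find; lose)
open import Data.List.Membership.Propositional.Properties
  using (∈-map⁺; ∈-map⁻; ∈-concatMap⁺; ∈-concatMap⁻; ∈-upTo⁺; ∈-upTo⁻; ∈-filter⁻)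
open import Data.List.Relation.Unary.Any using (here; there)
open import Data.Product using (_×_; _,_; proj₁; proj₂; uncurry)
open import Data.Sum using (_⊎_; inj₁; inj₂)
open import Data.Unit using (tt)
open import Function using (_∘_)
open import Relation.Binary.PropositionalEquality
open import Relation.Nullary using (¬_; yes; no; contradiction)
open import Data.Nat.Solver using (module +-*-Solver)
open import Data.Integer as ℤ using (ℤ) renaming (+_ to ⁺_)
open import Data.Integer.Solver renaming (module +-*-Solver to ℤ-Solver)
import Data.Integer.Properties as ℤ
open import Data.Rational as ℚ using (ℚ; mkℚ; 0ℚ; 1ℚ)
import Data.Rational.Properties as ℚ
open import Data.Nat.Coprimality using (1-coprimeTo) renaming (sym to coprime-sym)

T-∧-intro : ∀ {x y} → T x → T y → T (x ∧ y)
T-∧-intro {true} {true} _ _ = tt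

T-∧-fst : ∀ {x y} → T (x ∧ y) → T x
T-∧-fst {true} _ = tt

T-∧-snd : ∀ {x y} → T (x ∧ y) → T y
T-∧-snd {true} t = t

T-∨-inj₁ : ∀ {x y} → T x → T (x ∨ y)
T-∨-inj₁ {true} _ = tt

T-∨-inj₂ : ∀ {x y} → T y → T (x ∨ y)
T-∨-inj₂ {true} _ = tt
T-∨-inj₂ {false} t = t

T-∨-elim : ∀ {x y} → T (x ∨ y) → T x ⊎ T y
T-∨-elim {true} _ = inj₁ tt
T-∨-elim {false} t = inj₂ t

T-not⁺ : ∀ {x} → ¬ T x → T (not x)
T-not⁺ {true} ¬t = ¬t tt
T-not⁺ {false} _ = tt

T-not⁻ : ∀ {x} → T (not x) → ¬ T x
T-not⁻ {true} ()

T-implies : ∀ {x y} → T (not x ∨ y) → T x → T y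
T-implies {true} t _ = t

T⇒≡true : ∀ {x} → T x → x ≡ true
T⇒≡true {true} _ = refl

¬T⇒≡false : ∀ {x} → ¬ T x → x ≡ false
¬T⇒≡false {true} ¬t = contradiction tt ¬t
¬T⇒≡false {false} _ = refl

T-injective : ∀ {x y} → (T x → T y) → (T y → T x) → x ≡ y
T-injective {true} {true} _ _ = refl
T-injective {true} {false} to _ = contradiction tt to
T-injective {false} {true} _ from = contradiction tt from
T-injective {false} {false} _ _ = refl

𝟙 : Bool → ℕ
𝟙 b = if b then 1 else 0

≤ᵇ-true : ∀ {m n} → m ≤ n → (m ≤ᵇ n) ≡ true
≤ᵇ-true p = T⇒≡true (≤⇒≤ᵇ p)
≤ᵇ-false : ∀ {m n} → ¬ m ≤ n → (m ≤ᵇ n) ≡ false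
≤ᵇ-false {m} {n} p = ¬T⇒≡false (λ t → p (≤ᵇ⇒≤ m n t))
<ᵇ-true : ∀ {m n} → m < n → (m <ᵇ n) ≡ true
<ᵇ-true p = T⇒≡true (<⇒<ᵇ p)
<ᵇ-false : ∀ {m n} → ¬ m < n → (m <ᵇ n) ≡ false
<ᵇ-false {m} {n} p = ¬T⇒≡false (λ t → p (<ᵇ⇒< m n t))
≡ᵇ-true : ∀ {m n} → m ≡ n → (m ≡ᵇ n) ≡ true
≡ᵇ-true {m} {n} p = T⇒≡true (≡⇒≡ᵇ m n p)
≡ᵇ-false : ∀ {m n} → m ≢ n → (m ≡ᵇ n) ≡ false
≡ᵇ-false {m} {n} p = ¬T⇒≡false (λ t → p (≡ᵇ⇒≡ m n t))

≤ᵇ≡<ᵇ-suc : ∀ j n → (j ≤ᵇ n) ≡ (j <ᵇ suc n)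
≤ᵇ≡<ᵇ-suc zero n = refl
≤ᵇ≡<ᵇ-suc (suc j) n = refl

𝟙-∧false : ∀ b → 𝟙 (b ∧ false) ≡ 0
𝟙-∧false b = cong 𝟙 (∧-zeroʳ b)

𝟙-∧∧false : ∀ a b → 𝟙 (a ∧ (b ∧ false)) ≡ 0
𝟙-∧∧false a b = trans (cong (λ z → 𝟙 (a ∧ z)) (∧-zeroʳ b)) (𝟙-∧false a)

sumFrom : (ℕ → ℕ) → ℕ → ℕ → ℕ
sumFrom f a zero = 0
sumFrom f a (suc n) = f a + sumFrom f (suc a) n

private
  inInterval-head : ∀ a n → a ≤ a × a < a + suc n
  inInterval-head a n = ≤-refl , m<m+n a z<s

  inInterval-tail : ∀ {a n k} → suc a ≤ k → k < suc a + n → a ≤ k × k < a + suc n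
  inInterval-tail {a} {n} {k} a<k k< = <⇒≤ a<k , subst (k <_) (sym (+-suc a n)) k<

sumFrom-cong : ∀ {f g} a n → (∀ k → a ≤ k → k < a + n → f k ≡ g k) → sumFrom f a n ≡ sumFrom g a n
sumFrom-cong a zero eq = refl
sumFrom-cong a (suc n) eq =
  cong₂ _+_ (uncurry (eq a) (inInterval-head a n))
            (sumFrom-cong (suc a) n λ k a<k k< → uncurry (eq k) (inInterval-tail a<k k<))

sumFrom-zero : ∀ {f} a n → (∀ k → a ≤ k → k < a + n → f k ≡ 0) → sumFrom f a n ≡ 0
sumFrom-zero a zero eq = refl
sumFrom-zero a (suc n) eq =
  cong₂ _+_ (uncurry (eq a) (inInterval-head a n))
            (sumFrom-zero (suc a) n λ k a<k k< → uncurry (eq k) (inInterval-tail a<k k<))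

sumFrom-+ : ∀ f a m n → sumFrom f a (m + n) ≡ sumFrom f a m + sumFrom f (a + m) n
sumFrom-+ f a zero n = cong (λ b → sumFrom f b n) (sym (+-identityʳ a))
sumFrom-+ f a (suc m) n = begin
  f a + sumFrom f (suc a) (m + n)
    ≡⟨ cong (f a +_) (sumFrom-+ f (suc a) m n) ⟩
  f a + (sumFrom f (suc a) m + sumFrom f (suc a + m) n)
    ≡⟨ +-assoc (f a) _ _ ⟨
  f a + sumFrom f (suc a) m + sumFrom f (suc a + m) n
    ≡⟨ cong (λ b → f a + sumFrom f (suc a) m + sumFrom f b n) (+-suc a m) ⟨
  f a + sumFrom f (suc a) m + sumFrom f (a + suc m) n ∎
  where open ≡-Reasoning

sumFrom-snoc : ∀ f a n → sumFrom f a (suc n) ≡ sumFrom f a n + f (a + n)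
sumFrom-snoc f a n = begin
  sumFrom f a (suc n)                 ≡⟨ cong (sumFrom f a) (+-comm 1 n) ⟩
  sumFrom f a (n + 1)                 ≡⟨ sumFrom-+ f a n 1 ⟩
  sumFrom f a n + (f (a + n) + 0)     ≡⟨ cong (sumFrom f a n +_) (+-identityʳ _) ⟩
  sumFrom f a n + f (a + n)           ∎
  where open ≡-Reasoning

sumFrom-single : ∀ {f} a n c → a ≤ c → c < a + n →
                 (∀ k → a ≤ k → k < a + n → k ≢ c → f k ≡ 0) → sumFrom f a n ≡ f c
sumFrom-single a zero c a≤c c< _ = contradiction (subst (c <_) (+-identityʳ a) c<) (≤⇒≯ a≤c)
sumFrom-single {f} a (suc n) c a≤c c< zeros with a ≟ c
... | yes refl = begin
  f a + sumFrom f (suc a) n   ≡⟨ cong (f a +_) (sumFrom-zero (suc a) n λ k a<k k< →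
                                   uncurry (zeros k) (inInterval-tail a<k k<) (>⇒≢ a<k)) ⟩
  f a + 0                     ≡⟨ +-identityʳ (f a) ⟩
  f a                         ∎
  where open ≡-Reasoning
... | no a≢c = begin
  f a + sumFrom f (suc a) n   ≡⟨ cong (_+ sumFrom f (suc a) n) (uncurry (zeros a) (inInterval-head a n) a≢c) ⟩
  sumFrom f (suc a) n         ≡⟨ sumFrom-single (suc a) n c (≤∧≢⇒< a≤c a≢c) (subst (c <_) (+-suc a n) c<)
                                   (λ k a<k k< → uncurry (zeros k) (inInterval-tail a<k k<)) ⟩
  f c                         ∎
  where open ≡-Reasoning

sumFrom-𝟙-unique : ∀ a n (G Q : ℕ → Bool) c₀ P → (T P → a ≤ c₀ × c₀ < a + n) →
                   (∀ c → T (Q c) → c ≡ c₀) → (T P → T (Q c₀)) →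
                   sumFrom (λ c → 𝟙 (G c ∧ (Q c ∧ P))) a n ≡ 𝟙 (G c₀ ∧ P)
sumFrom-𝟙-unique a n G Q c₀ false _ _ _ =
  trans (sumFrom-zero a n λ c _ _ → cong 𝟙 (trans (cong (G c ∧_) (∧-zeroʳ (Q c))) (∧-zeroʳ (G c))))
        (cong 𝟙 (sym (∧-zeroʳ (G c₀))))
sumFrom-𝟙-unique a n G Q c₀ true inRange onlyAt atC₀ =
  trans (sumFrom-single a n c₀ (proj₁ (inRange tt)) (proj₂ (inRange tt)) λ c _ _ c≢c₀ →
           cong 𝟙 (trans (cong (λ q → G c ∧ (q ∧ true)) (¬T⇒≡false (c≢c₀ ∘ onlyAt c))) (∧-zeroʳ (G c))))
        (cong (λ q → 𝟙 (G c₀ ∧ (q ∧ true))) (T⇒≡true (atC₀ tt)))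

sumFrom-prefix : ∀ {f g} a n m → (∀ k → a ≤ k → k < a + n → f k ≡ g k) →
                 (∀ k → a + n ≤ k → k < a + n + m → f k ≡ 0) → sumFrom f a (n + m) ≡ sumFrom g a n
sumFrom-prefix {f} {g} a n m f≡g f≡0 = begin
  sumFrom f a (n + m)                    ≡⟨ sumFrom-+ f a n m ⟩
  sumFrom f a n + sumFrom f (a + n) m    ≡⟨ cong₂ _+_ (sumFrom-cong a n f≡g) (sumFrom-zero (a + n) m f≡0) ⟩
  sumFrom g a n + 0                      ≡⟨ +-identityʳ _ ⟩
  sumFrom g a n                          ∎
  where open ≡-Reasoning

sumFrom-suffix : ∀ {f g} a n m b → a + n ≡ b → (∀ k → a ≤ k → k < a + n → f k ≡ 0) →
                 (∀ k → b ≤ k → k < b + m → f k ≡ g k) → sumFrom f a (n + m) ≡ sumFrom g b m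
sumFrom-suffix {f} {g} a n m b refl f≡0 f≡g = begin
  sumFrom f a (n + m)                    ≡⟨ sumFrom-+ f a n m ⟩
  sumFrom f a n + sumFrom f (a + n) m    ≡⟨ cong₂ _+_ (sumFrom-zero a n f≡0) (sumFrom-cong (a + n) m f≡g) ⟩
  sumFrom g (a + n) m                    ∎
  where open ≡-Reasoning

countᵇ : {A : Set} → List A → (A → Bool) → ℕ
countᵇ [] P = 0
countᵇ (x ∷ xs) P = 𝟙 (P x) + countᵇ xs P

count≡countᵇ : ∀ xs P → count xs P ≡ countᵇ xs P
count≡countᵇ [] P = refl
count≡countᵇ (x ∷ xs) P = cong (𝟙 (P x) +_) (count≡countᵇ xs P)

module _ {A : Set} where

  countᵇ-++ : ∀ (xs ys : List A) P → countᵇ (xs ++ ys) P ≡ countᵇ xs P + countᵇ ys P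
  countᵇ-++ [] ys P = refl
  countᵇ-++ (x ∷ xs) ys P = trans (cong (𝟙 (P x) +_) (countᵇ-++ xs ys P)) (sym (+-assoc (𝟙 (P x)) _ _))

  countᵇ-map : ∀ {B : Set} (g : B → A) xs P → countᵇ (map g xs) P ≡ countᵇ xs (P ∘ g)
  countᵇ-map g [] P = refl
  countᵇ-map g (x ∷ xs) P = cong (𝟙 (P (g x)) +_) (countᵇ-map g xs P)

  countᵇ-filter : ∀ (Q P : A → Bool) xs → countᵇ (filter (T? ∘ Q) xs) P ≡ countᵇ xs (λ x → Q x ∧ P x)
  countᵇ-filter Q P [] = refl
  countᵇ-filter Q P (x ∷ xs) with Q x
  ... | true = cong (𝟙 (P x) +_) (countᵇ-filter Q P xs)
  ... | false = countᵇ-filter Q P xs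

  countᵇ-concatMap-applyUpTo : ∀ (R : ℕ → List A) P f a n → (∀ k → f k ≡ a + k) →
    countᵇ (concatMap R (applyUpTo f n)) P ≡ sumFrom (λ x → countᵇ (R x) P) a n
  countᵇ-concatMap-applyUpTo R P f a zero f≗a+ = refl
  countᵇ-concatMap-applyUpTo R P f a (suc n) f≗a+ = begin
    countᵇ (R (f 0) ++ concatMap R (applyUpTo (f ∘ suc) n)) P
      ≡⟨ countᵇ-++ (R (f 0)) _ P ⟩
    countᵇ (R (f 0)) P + countᵇ (concatMap R (applyUpTo (f ∘ suc) n)) P
      ≡⟨ cong₂ (λ x s → countᵇ (R x) P + s) (trans (f≗a+ 0) (+-identityʳ a))
               (countᵇ-concatMap-applyUpTo R P (f ∘ suc) (suc a) n λ k → trans (f≗a+ (suc k)) (+-suc a k)) ⟩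
    countᵇ (R a) P + sumFrom (λ x → countᵇ (R x) P) (suc a) n ∎
    where open ≡-Reasoning

countᵇ-applyUpTo : ∀ P f a n → (∀ k → f k ≡ a + k) → countᵇ (applyUpTo f n) P ≡ sumFrom (𝟙 ∘ P) a n
countᵇ-applyUpTo P f a zero f≗a+ = refl
countᵇ-applyUpTo P f a (suc n) f≗a+ =
  cong₂ (λ x s → 𝟙 (P x) + s) (trans (f≗a+ 0) (+-identityʳ a))
        (countᵇ-applyUpTo P (f ∘ suc) (suc a) n λ k → trans (f≗a+ (suc k)) (+-suc a k))

countᵇ-interval : ∀ P a n → countᵇ (map (a +_) (upTo n)) P ≡ sumFrom (𝟙 ∘ P) a n
countᵇ-interval P a n =
  trans (cong (λ xs → countᵇ xs P) (map-applyUpTo (λ k → k) (a +_) n)) (countᵇ-applyUpTo P (a +_) a n λ _ → refl)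

countᵇ-concatMap-interval : ∀ {A : Set} (R : ℕ → List A) P a n →
  countᵇ (concatMap R (map (a +_) (upTo n))) P ≡ sumFrom (λ x → countᵇ (R x) P) a n
countᵇ-concatMap-interval R P a n =
  trans (cong (λ xs → countᵇ (concatMap R xs) P) (map-applyUpTo (λ k → k) (a +_) n))
        (countᵇ-concatMap-applyUpTo R P (a +_) a n λ _ → refl)

∈-interval⁻ : ∀ {a n x} → x ∈ map (a +_) (upTo n) → a ≤ x × x < a + n
∈-interval⁻ {a} x∈ with k , k∈ , refl ← ∈-map⁻ (a +_) x∈ = m≤m+n a k , +-monoʳ-< a (∈-upTo⁻ k∈)

∈-interval⁺ : ∀ {a n x} → a ≤ x → x < a + n → x ∈ map (a +_) (upTo n)
∈-interval⁺ {a} {n} {x} a≤x x< =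
  subst (_∈ _) (m+[n∸m]≡n a≤x) (∈-map⁺ (a +_) (∈-upTo⁺ (+-cancelˡ-< a _ _ (subst (_< a + n) (sym (m+[n∸m]≡n a≤x)) x<))))

allᵇ⁻ : ∀ {xs P x} → T (allᵇ xs P) → x ∈ xs → T (P x)
allᵇ⁻ {_ ∷ _} {P} {x} all (here refl) with P x
... | true = tt
allᵇ⁻ {y ∷ _} {P} all (there x∈) with P y
... | true = allᵇ⁻ all x∈

allᵇ⁺ : ∀ {xs P} → (∀ {x} → x ∈ xs → T (P x)) → T (allᵇ xs P)
allᵇ⁺ {[]} h = tt
allᵇ⁺ {x ∷ xs} {P} h with P x | h (here refl)
... | true | _ = allᵇ⁺ (h ∘ there)

row-length : ∀ i L → 1 ≤ i → suc (i + L ∸ 1) ∸ i ≡ L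
row-length (suc i) L _ = m+n∸m≡n i L

∈-boxes⁻ : ∀ {lam r c} → (r , c) ∈ boxes lam → IsBox lam r c
∈-boxes⁻ {lam} rc∈ with find (∈-concatMap⁻ _ {xs = range 1 (ℓ lam)} rc∈)
... | r , r∈ , rc∈row with ∈-map⁻ (r ,_) rc∈row
... | c , c∈ , refl with ∈-interval⁻ r∈ | ∈-interval⁻ c∈
... | 1≤r , r< | r≤c , c< = 1≤r , ℕ.s≤s⁻¹ r< , r≤c , subst (λ L → c < r + L) (row-length r (part lam r) 1≤r) c<

∈-boxes⁺ : ∀ {lam r c} → IsBox lam r c → (r , c) ∈ boxes lam
∈-boxes⁺ {lam} {r} {c} (1≤r , r≤ℓ , r≤c , c<) =
  ∈-concatMap⁺ _ (lose (∈-interval⁺ 1≤r (s≤s r≤ℓ))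
    (∈-map⁺ (r ,_) (∈-interval⁺ r≤c (subst (λ L → c < r + L) (sym (row-length r (part lam r) 1≤r)) c<))))

count-boxes : ∀ lam P → count (boxes lam) P ≡ sumFrom (λ r → sumFrom (λ c → 𝟙 (P (r , c))) r (part lam r)) 1 (ℓ lam)
count-boxes lam P = begin
  count (boxes lam) P
    ≡⟨ count≡countᵇ (boxes lam) P ⟩
  countᵇ (boxes lam) P
    ≡⟨ countᵇ-concatMap-interval _ P 1 (ℓ lam) ⟩
  sumFrom (λ r → countᵇ (map (r ,_) (range r (r + part lam r ∸ 1))) P) 1 (ℓ lam)
    ≡⟨ sumFrom-cong 1 (ℓ lam) (λ r 1≤r _ → begin
         countᵇ (map (r ,_) (range r (r + part lam r ∸ 1))) P
           ≡⟨ countᵇ-map (r ,_) (range r (r + part lam r ∸ 1)) P ⟩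
         countᵇ (range r (r + part lam r ∸ 1)) (λ c → P (r , c))
           ≡⟨ countᵇ-interval (λ c → P (r , c)) r (suc (r + part lam r ∸ 1) ∸ r) ⟩
         sumFrom (λ c → 𝟙 (P (r , c))) r (suc (r + part lam r ∸ 1) ∸ r)
           ≡⟨ cong (sumFrom (λ c → 𝟙 (P (r , c))) r) (row-length r (part lam r) 1≤r) ⟩
         sumFrom (λ c → 𝟙 (P (r , c))) r (part lam r) ∎) ⟩
  sumFrom (λ r → sumFrom (λ c → 𝟙 (P (r , c))) r (part lam r)) 1 (ℓ lam) ∎
  where open ≡-Reasoning

part-beyond-length : ∀ l r → ℓ l < r → part l r ≡ 0
part-beyond-length [] zero _ = refl
part-beyond-length [] (suc r) _ = refl
part-beyond-length (x ∷ l) (suc (suc r)) (s≤s ℓ<r) = part-beyond-length l (suc r) ℓ<r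

part-positive⇒≤length : ∀ l r → 1 ≤ part l r → r ≤ ℓ l
part-positive⇒≤length l r 1≤part with r ≤? ℓ l
... | yes r≤ℓ = r≤ℓ
... | no r≰ℓ = contradiction (part-beyond-length l r (≰⇒> r≰ℓ)) (>⇒≢ 1≤part)

part-positive : ∀ {l} → Strict l → ∀ r → 1 ≤ r → r ≤ ℓ l → 1 ≤ part l r
part-positive (one 0<a) (suc zero) _ _ = 0<a
part-positive (cons b<a _) (suc zero) _ _ = ≤-trans (s≤s z≤n) b<a
part-positive (one _) (suc (suc r)) _ (s≤s ())
part-positive (cons _ sl) (suc (suc r)) _ (s≤s r≤ℓ) = part-positive sl (suc r) (s≤s z≤n) r≤ℓ

part-decreasing : ∀ {l} → Strict l → ∀ r → 1 ≤ r → r < ℓ l → part l (suc r) < part l r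
part-decreasing (one _) (suc zero) _ (s≤s ())
part-decreasing (cons b<a _) (suc zero) _ _ = b<a
part-decreasing (cons _ sl) (suc (suc r)) _ (s≤s r<ℓ) = part-decreasing sl (suc r) (s≤s z≤n) r<ℓ

-- ν is padded with zeros, so strictness only constrains its nonzero parts.
record ShiftedIdeal (lam ν : List ℕ) : Set where
  field
    ⊆lam       : ∀ r → part ν r ≤ part lam r
    decreasing : ∀ r → 1 ≤ r → part ν (suc r) ≡ 0 ⊎ part ν (suc r) < part ν r

candidates-⊆ : ∀ lam ν → ν ∈ candidates lam → ∀ r → part ν r ≤ part lam r
candidates-⊆ [] ν (here refl) zero = z≤n
candidates-⊆ [] ν (here refl) (suc r) = z≤n
candidates-⊆ (x ∷ l) ν ν∈ r with find (∈-concatMap⁻ (λ y → map (y ∷_) (candidates l)) {xs = upTo (suc x)} ν∈)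
... | y , y∈ , ν∈ys with ∈-map⁻ (y ∷_) ν∈ys
... | ys , ys∈ , refl with r
... | zero = z≤n
... | suc zero = ℕ.s≤s⁻¹ (∈-upTo⁻ y∈)
... | suc (suc r) = candidates-⊆ l ys ys∈ (suc r)

strictPadded-parts : ∀ ν → T (strictPaddedᵇ ν) → ∀ r → 1 ≤ r → part ν (suc r) ≡ 0 ⊎ part ν (suc r) < part ν r
strictPadded-parts [] _ (suc r) _ = inj₁ refl
strictPadded-parts (x ∷ []) _ (suc zero) _ = inj₁ refl
strictPadded-parts (x ∷ []) _ (suc (suc r)) _ = inj₁ refl
strictPadded-parts (x ∷ y ∷ l) sp (suc zero) _ with y ≡ᵇ 0 in y≡0 | y <ᵇ x in y<x
... | true | _ = inj₁ (≡ᵇ⇒≡ y 0 (subst T (sym y≡0) tt))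
... | false | true = inj₂ (<ᵇ⇒< y x (subst T (sym y<x) tt))
strictPadded-parts (x ∷ y ∷ l) sp (suc (suc r)) _ =
  strictPadded-parts (y ∷ l) (T-∧-snd {(y ≡ᵇ 0) ∨ (y <ᵇ x)} sp) (suc r) (s≤s z≤n)

ideals⇒ShiftedIdeal : ∀ {lam ν} → ν ∈ ideals lam → ShiftedIdeal lam ν
ideals⇒ShiftedIdeal {lam} {ν} ν∈ with ∈-filter⁻ (λ ν → T? (strictPaddedᵇ ν)) {xs = candidates lam} ν∈
... | ν∈cand , sp = record { ⊆lam = candidates-⊆ lam ν ν∈cand ; decreasing = strictPadded-parts ν sp }

-- Where the toggles fire

ltᵇ⇒ : ∀ r' c' r c → T (ltᵇ (r' , c') (r , c)) → r' ≤ r × c' ≤ c × ¬ (r' ≡ r × c' ≡ c)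
ltᵇ⇒ r' c' r c lt =
  ≤ᵇ⇒≤ r' r (T-∧-fst (T-∧-fst lt)) , ≤ᵇ⇒≤ c' c (T-∧-snd {r' ≤ᵇ r} (T-∧-fst lt)) ,
  λ { (refl , refl) → T-not⁻ (T-∧-snd {leᵇ (r' , c') (r , c)} lt) (T-∧-intro (≡⇒≡ᵇ r' r refl) (≡⇒≡ᵇ c' c refl)) }

ltᵇ⁺ : ∀ r' c' r c → r' ≤ r → c' ≤ c → ¬ (r' ≡ r × c' ≡ c) → T (ltᵇ (r' , c') (r , c))
ltᵇ⁺ r' c' r c r'≤r c'≤c ≢ =
  T-∧-intro (T-∧-intro (≤⇒≤ᵇ r'≤r) (≤⇒≤ᵇ c'≤c))
            (T-not⁺ λ eq → ≢ (≡ᵇ⇒≡ r' r (T-∧-fst eq) , ≡ᵇ⇒≡ c' c (T-∧-snd {r' ≡ᵇ r} eq)))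

allᵇ-boxes⁺ : ∀ lam P → (∀ {r c} → IsBox lam r c → T (P (r , c))) → T (allᵇ (boxes lam) P)
allᵇ-boxes⁺ lam P h = allᵇ⁺ {boxes lam} {P} λ {(r , c)} rc∈ → h (∈-boxes⁻ rc∈)

allᵇ-boxes⁻ : ∀ lam P → T (allᵇ (boxes lam) P) → ∀ {r c} → IsBox lam r c → T (P (r , c))
allᵇ-boxes⁻ lam P all box = allᵇ⁻ {boxes lam} {P} all (∈-boxes⁺ box)

+-gap-monoʳ : ∀ x {y z} → 2 + y ≤ z → 2 + (x + y) ≤ x + z
+-gap-monoʳ x {y} {z} le = subst (_≤ x + z) (trans (+-suc x (suc y)) (cong suc (+-suc x y))) (+-monoʳ-≤ x le)

+-gap-cancelˡ : ∀ x {y z} → 2 + (x + y) ≤ x + z → 2 + y ≤ z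
+-gap-cancelˡ x {y} {z} le = +-cancelˡ-≤ x _ _ (subst (_≤ x + z) (sym (trans (+-suc x (suc y)) (cong suc (+-suc x y)))) le)

module Toggles (lam ν : List ℕ) (sl : Strict lam) (ν-ideal : ShiftedIdeal lam ν) where

  open ShiftedIdeal ν-ideal

  a L : ℕ → ℕ
  a = part ν
  L = part lam

  -- (r , end r) is the first box of row r outside ν.
  end : ℕ → ℕ
  end r = r + a r

  lastCol : ℕ → ℕ
  lastCol r = end r ∸ 1

  -- T⁺ can only toggle (r , end r) and T⁻ only (r , lastCol r); these say when they do.
  addable removable : ℕ → Bool
  addable r = (a r <ᵇ L r) ∧ ((r ≡ᵇ 1) ∨ (suc (suc (a r)) ≤ᵇ a (r ∸ 1)))
  removable r = (1 ≤ᵇ a r) ∧ ((a r ≡ᵇ 1) ∨ not (suc (a (suc r)) ≡ᵇ a r))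

  ∈ν⁺ : ∀ {r c} → 1 ≤ r → r ≤ c → c < end r → T (inShapeᵇ ν (r , c))
  ∈ν⁺ 1≤r r≤c c< = T-∧-intro (≤⇒≤ᵇ 1≤r) (T-∧-intro (≤⇒≤ᵇ r≤c) (<⇒<ᵇ c<))

  ∈ν⁻ : ∀ {r c} → T (inShapeᵇ ν (r , c)) → c < end r
  ∈ν⁻ {r} {c} c∈ = <ᵇ⇒< c (end r) (T-∧-snd {r ≤ᵇ c} (T-∧-snd {1 ≤ᵇ r} c∈))

  ∉ν : ∀ {r c} → end r ≤ c → T (not (inShapeᵇ ν (r , c)))
  ∉ν {r} {c} end≤c = T-not⁺ λ c∈ → <⇒≱ (∈ν⁻ {r} {c} c∈) end≤c

  end-antitone : ∀ {r s} → 1 ≤ r → r ≤ s → 1 ≤ a s → end s ≤ end r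
  end-antitone {r} {s} 1≤r r≤s 1≤as =
    subst (λ s → end s ≤ end r) (m+[n∸m]≡n r≤s) (go (s ∸ r) (subst (λ s → 1 ≤ a s) (sym (m+[n∸m]≡n r≤s)) 1≤as))
    where
    go : ∀ d → 1 ≤ a (r + d) → end (r + d) ≤ end r
    go zero _ = ≤-reflexive (cong end (+-identityʳ r))
    go (suc d) 1≤a rewrite +-suc r d with decreasing (r + d) (≤-trans 1≤r (m≤m+n r d))
    ... | inj₁ a≡0 = contradiction a≡0 (>⇒≢ 1≤a)
    ... | inj₂ a< = begin
      suc (r + d) + a (suc (r + d))   ≡⟨ sym (+-suc (r + d) _) ⟩
      r + d + suc (a (suc (r + d)))   ≤⟨ +-monoʳ-≤ (r + d) a< ⟩
      end (r + d)                     ≤⟨ go d (≤-trans 1≤a (<⇒≤ a<)) ⟩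
      end r                           ∎
      where open ≤-Reasoning

  T⁺⇒below∈ν : ∀ {r c} → T (T⁺ᵇ lam ν (r , c)) →
               ∀ {r' c'} → IsBox lam r' c' → T (ltᵇ (r' , c') (r , c)) → c' < end r'
  T⁺⇒below∈ν {r} {c} t {r'} {c'} box lt =
    ∈ν⁻ {r'} {c'} (T-implies {ltᵇ (r' , c') (r , c)}
                    (allᵇ-boxes⁻ lam _ (T-∧-snd {not (inShapeᵇ ν (r , c))} t) box) lt)

  T⁺⇒col≡end : ∀ {r c} → IsBox lam r c → T (T⁺ᵇ lam ν (r , c)) → c ≡ end r
  T⁺⇒col≡end {r} {zero} (1≤r , _ , r≤0 , _) _ = contradiction (≤-trans 1≤r r≤0) λ ()
  T⁺⇒col≡end {r} {suc c} box@(1≤r , r≤ℓ , r≤c+1 , c+1<) t with end r ≤? suc c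
  ... | no end≰c+1 = contradiction (∈ν⁺ 1≤r r≤c+1 (≰⇒> end≰c+1)) (T-not⁻ (T-∧-fst t))
  ... | yes end≤c+1 with m≤n⇒m<n∨m≡n end≤c+1
  ...   | inj₂ end≡c+1 = sym end≡c+1
  ...   | inj₁ (s≤s end≤c) =
    contradiction (T⁺⇒below∈ν t (1≤r , r≤ℓ , ≤-trans (m≤m+n r (a r)) end≤c , <-trans (n<1+n c) c+1<)
                                (ltᵇ⁺ r c r (suc c) ≤-refl (n≤1+n c) λ { (_ , eq) → 1+n≢n (sym eq) }))
                  (≤⇒≯ end≤c)

  -- The box just above (r , end r) lies in the diagram because λ is strict.
  T⁺⇒gapAbove : ∀ {r} → IsBox lam r (end r) → T (T⁺ᵇ lam ν (r , end r)) →
                T ((r ≡ᵇ 1) ∨ (suc (suc (a r)) ≤ᵇ a (r ∸ 1)))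
  T⁺⇒gapAbove {suc zero} _ _ = tt
  T⁺⇒gapAbove {suc (suc r)} (_ , r+2≤ℓ , r+2≤end , end<) t =
    ≤⇒≤ᵇ (+-gap-cancelˡ r (ℕ.s≤s⁻¹ (T⁺⇒below∈ν t boxAbove
      (ltᵇ⁺ (suc r) (end R) R (end R) (n≤1+n _) ≤-refl λ { (eq , _) → 1+n≢n (sym eq) }))))
    where
    R = suc (suc r)
    boxAbove : IsBox lam (suc r) (end R)
    boxAbove = s≤s z≤n , ≤-trans (n≤1+n _) r+2≤ℓ , ≤-trans (n≤1+n _) r+2≤end , (begin-strict
      end R                      <⟨ end< ⟩
      R + L R                    ≡⟨ +-suc (suc r) (L R) ⟨
      suc r + suc (L R)          ≤⟨ +-monoʳ-≤ (suc r) (part-decreasing sl (suc r) (s≤s z≤n) r+2≤ℓ) ⟩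
      suc r + L (suc r)          ∎)
      where open ≤-Reasoning

  T⁺⇒addable : ∀ {r c} → IsBox lam r c → T (T⁺ᵇ lam ν (r , c)) → c ≡ end r × T (addable r)
  T⁺⇒addable {r} box t with refl ← T⁺⇒col≡end box t =
    refl , T-∧-intro (<⇒<ᵇ (+-cancelˡ-< r _ _ (proj₂ (proj₂ (proj₂ box))))) (T⁺⇒gapAbove box t)

  addable⇒rowsAbove∈ν : ∀ {r r' c'} → T (addable r) → 1 ≤ r' → r' < r → c' ≤ end r → c' < end r'
  addable⇒rowsAbove∈ν {zero} _ _ ()
  addable⇒rowsAbove∈ν {suc zero} _ (s≤s z≤n) (s≤s ())
  addable⇒rowsAbove∈ν {suc (suc r)} {r'} {c'} ad 1≤r' r'<r+2 c'≤ = begin-strict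
    c'                   ≤⟨ c'≤ ⟩
    end (suc (suc r))    <⟨ s≤s (+-gap-monoʳ r gap) ⟩
    end (suc r)          ≤⟨ end-antitone 1≤r' (ℕ.s≤s⁻¹ r'<r+2) (≤-trans (s≤s z≤n) gap) ⟩
    end r'               ∎
    where
    open ≤-Reasoning
    gap : 2 + a (suc (suc r)) ≤ a (suc r)
    gap = ≤ᵇ⇒≤ _ _ (T-∧-snd {a (suc (suc r)) <ᵇ L (suc (suc r))} ad)

  addable⇒T⁺ : ∀ {r} → T (addable r) → T (T⁺ᵇ lam ν (r , end r))
  addable⇒T⁺ {r} ad = T-∧-intro (∉ν {r} {end r} ≤-refl) (allᵇ-boxes⁺ lam _ below∈ν)
    where
    below∈ν : ∀ {r' c'} → IsBox lam r' c' → T (not (ltᵇ (r' , c') (r , end r)) ∨ inShapeᵇ ν (r' , c'))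
    below∈ν {r'} {c'} (1≤r' , _ , r'≤c' , _) with ltᵇ (r' , c') (r , end r) in lt
    ... | false = tt
    ... | true with ltᵇ⇒ r' c' r (end r) (subst T (sym lt) tt)
    ...   | r'≤r , c'≤ , ≢ with r' ≟ r
    ...     | yes refl = ∈ν⁺ 1≤r' r'≤c' (≤∧≢⇒< c'≤ λ eq → ≢ (refl , eq))
    ...     | no r'≢r = ∈ν⁺ 1≤r' r'≤c' (addable⇒rowsAbove∈ν ad 1≤r' (≤∧≢⇒< r'≤r r'≢r) c'≤)

  T⁺-characterisation : ∀ {r c} → IsBox lam r c → T⁺ᵇ lam ν (r , c) ≡ (c ≡ᵇ end r) ∧ addable r
  T⁺-characterisation {r} {c} box = T-injective
    (λ t → T-∧-intro (≡⇒≡ᵇ c (end r) (proj₁ (T⁺⇒addable box t))) (proj₂ (T⁺⇒addable box t)))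
    (λ t → subst (λ c → T (T⁺ᵇ lam ν (r , c))) (sym (≡ᵇ⇒≡ c (end r) (T-∧-fst t)))
                 (addable⇒T⁺ (T-∧-snd {c ≡ᵇ end r} t)))

  T⁻⇒above∉ν : ∀ {r c} → T (T⁻ᵇ lam ν (r , c)) →
               ∀ {r' c'} → IsBox lam r' c' → T (ltᵇ (r , c) (r' , c')) → ¬ T (inShapeᵇ ν (r' , c'))
  T⁻⇒above∉ν {r} {c} t {r'} {c'} box lt =
    T-not⁻ (T-implies {ltᵇ (r , c) (r' , c')} (allᵇ-boxes⁻ lam _ (T-∧-snd {inShapeᵇ ν (r , c)} t) box) lt)

  T⁻⇒col≡end : ∀ {r c} → IsBox lam r c → T (T⁻ᵇ lam ν (r , c)) → suc c ≡ end r
  T⁻⇒col≡end {r} {c} (1≤r , r≤ℓ , r≤c , _) t with m≤n⇒m<n∨m≡n (∈ν⁻ {r} {c} (T-∧-fst t))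
  ... | inj₂ c+1≡end = c+1≡end
  ... | inj₁ c+1<end =
    contradiction (∈ν⁺ 1≤r (m≤n⇒m≤1+n r≤c) c+1<end)
                  (T⁻⇒above∉ν {r} {c} t (1≤r , r≤ℓ , m≤n⇒m≤1+n r≤c , <-≤-trans c+1<end (+-monoʳ-≤ r (⊆lam r)))
                                (ltᵇ⁺ r c r (suc c) ≤-refl (n≤1+n c) λ { (_ , eq) → 1+n≢n (sym eq) }))

  T⁻⇒removable : ∀ {r c} → IsBox lam r c → T (T⁻ᵇ lam ν (r , c)) → suc c ≡ end r → T (removable r)
  T⁻⇒removable {r} {c} (1≤r , _ , r≤c , _) t c+1≡end = T-∧-intro (≤⇒≤ᵇ 1≤ar) noStepBelow
    where
    1≤ar : 1 ≤ a r
    1≤ar = +-cancelˡ-≤ r 1 (a r) (subst (_≤ end r) (+-comm 1 r) (subst (suc r ≤_) c+1≡end (s≤s r≤c)))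

    -- If ν_{r+1} = ν_r − 1 ≥ 1, the box (r + 1 , c) would be in ν above (r , c).
    noStepBelow : T ((a r ≡ᵇ 1) ∨ not (suc (a (suc r)) ≡ᵇ a r))
    noStepBelow with a r ≟ 1
    ... | yes ar≡1 = T-∨-inj₁ (≡⇒≡ᵇ (a r) 1 ar≡1)
    ... | no ar≢1 = T-∨-inj₂ {a r ≡ᵇ 1} (T-not⁺ λ eq → stepBelow (≡ᵇ⇒≡ (suc (a (suc r))) (a r) eq))
      where
      stepBelow : suc (a (suc r)) ≢ a r
      stepBelow step = T⁻⇒above∉ν {r} {c} t boxBelow (ltᵇ⁺ r c (suc r) c (n≤1+n r) ≤-refl λ { (eq , _) → 1+n≢n (sym eq) })
                         (∈ν⁺ (s≤s z≤n) r+1≤c (subst (_< suc r + a (suc r)) (sym c≡) ≤-refl))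
        where
        1≤ar+1 : 1 ≤ a (suc r)
        1≤ar+1 = n≢0⇒n>0 λ z → ar≢1 (trans (sym step) (cong suc z))
        c≡ : c ≡ r + a (suc r)
        c≡ = suc-injective (trans c+1≡end (trans (cong (r +_) (sym step)) (+-suc r (a (suc r)))))
        r+1≤c : suc r ≤ c
        r+1≤c = subst (suc r ≤_) (sym c≡) (subst (_≤ r + a (suc r)) (+-comm r 1) (+-monoʳ-≤ r 1≤ar+1))
        boxBelow : IsBox lam (suc r) c
        boxBelow = s≤s z≤n , part-positive⇒≤length lam (suc r) (≤-trans 1≤ar+1 (⊆lam (suc r))) , r+1≤c ,
                   subst (_< suc r + L (suc r)) (sym c≡) (s≤s (+-monoʳ-≤ r (⊆lam (suc r))))

  removable⇒rowsBelow∉ν : ∀ {r c r' c'} → 1 ≤ r → T (removable r) → suc c ≡ end r →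
                          IsBox lam r' c' → r < r' → c ≤ c' → end r' ≤ c'
  removable⇒rowsBelow∉ν {r} {c} {r'} {c'} 1≤r rm c+1≡end (_ , _ , r'≤c' , _) r<r' c≤c' with a r' ≟ 0
  ... | yes ar'≡0 = subst (_≤ c') (sym (trans (cong (r' +_) ar'≡0) (+-identityʳ r'))) r'≤c'
  ... | no ar'≢0 = begin
    end r'        ≤⟨ end-r'≤ ⟩
    end (suc r)   ≤⟨ ℕ.s≤s⁻¹ (subst (2 + (r + a (suc r)) ≤_) (sym c+1≡end) (+-gap-monoʳ r gap)) ⟩
    c             ≤⟨ c≤c' ⟩
    c'            ∎
    where
    open ≤-Reasoning
    end-r'≤ : end r' ≤ end (suc r)
    end-r'≤ = end-antitone (s≤s z≤n) r<r' (n≢0⇒n>0 ar'≢0)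
    1≤ar+1 : 1 ≤ a (suc r)
    1≤ar+1 = n≢0⇒n>0 λ ar+1≡0 → ar'≢0 (n≤0⇒n≡0 (+-cancelˡ-≤ r' (a r') 0 (begin
      r' + a r'          ≤⟨ end-r'≤ ⟩
      suc r + a (suc r)  ≡⟨ cong (suc r +_) ar+1≡0 ⟩
      suc r + 0          ≡⟨ +-identityʳ (suc r) ⟩
      suc r              ≤⟨ r<r' ⟩
      r'                 ≡⟨ +-identityʳ r' ⟨
      r' + 0             ∎)))
    gap : 2 + a (suc r) ≤ a r
    gap with decreasing r 1≤r
    ... | inj₁ ar+1≡0 = contradiction ar+1≡0 (>⇒≢ 1≤ar+1)
    ... | inj₂ ar+1<ar with T-∨-elim (T-∧-snd {1 ≤ᵇ a r} rm)
    ...   | inj₁ ar≡1 = contradiction (subst (a (suc r) <_) (≡ᵇ⇒≡ (a r) 1 ar≡1) ar+1<ar) (≤⇒≯ 1≤ar+1)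
    ...   | inj₂ noStep = ≤∧≢⇒< ar+1<ar λ eq → T-not⁻ noStep (≡⇒≡ᵇ (suc (a (suc r))) (a r) eq)

  removable⇒T⁻ : ∀ {r c} → 1 ≤ r → r ≤ c → suc c ≡ end r → T (removable r) → T (T⁻ᵇ lam ν (r , c))
  removable⇒T⁻ {r} {c} 1≤r r≤c c+1≡end rm =
    T-∧-intro (∈ν⁺ 1≤r r≤c (subst (c <_) c+1≡end ≤-refl)) (allᵇ-boxes⁺ lam _ above∉ν)
    where
    above∉ν : ∀ {r' c'} → IsBox lam r' c' → T (not (ltᵇ (r , c) (r' , c')) ∨ not (inShapeᵇ ν (r' , c')))
    above∉ν {r'} {c'} box' with ltᵇ (r , c) (r' , c') in lt
    ... | false = tt
    ... | true with ltᵇ⇒ r c r' c' (subst T (sym lt) tt)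
    ...   | r≤r' , c≤c' , ≢ with r ≟ r'
    ...     | yes refl = ∉ν {r} {c'} (subst (_≤ c') c+1≡end (≤∧≢⇒< c≤c' λ eq → ≢ (refl , eq)))
    ...     | no r≢r' = ∉ν {r'} {c'} (removable⇒rowsBelow∉ν 1≤r rm c+1≡end box' (≤∧≢⇒< r≤r' r≢r') c≤c')

  T⁻-characterisation : ∀ {r c} → IsBox lam r c → T⁻ᵇ lam ν (r , c) ≡ (suc c ≡ᵇ end r) ∧ removable r
  T⁻-characterisation {r} {c} box@(1≤r , _ , r≤c , _) = T-injective
    (λ t → T-∧-intro (≡⇒≡ᵇ (suc c) (end r) (T⁻⇒col≡end box t)) (T⁻⇒removable box t (T⁻⇒col≡end box t)))
    (λ t → removable⇒T⁻ 1≤r r≤c (≡ᵇ⇒≡ (suc c) (end r) (T-∧-fst t)) (T-∧-snd {suc c ≡ᵇ end r} t))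

  rowSum-T⁺ : ∀ {r} → 1 ≤ r → r ≤ ℓ lam → (F G : Box → Bool) →
              (∀ c → F (r , c) ≡ G (r , c) ∧ T⁺ᵇ lam ν (r , c)) →
              sumFrom (λ c → 𝟙 (F (r , c))) r (L r) ≡ 𝟙 (G (r , end r) ∧ addable r)
  rowSum-T⁺ {r} 1≤r r≤ℓ F G F≡ =
    trans (sumFrom-cong r (L r) λ c r≤c c< →
             cong 𝟙 (trans (F≡ c) (cong (G (r , c) ∧_) (T⁺-characterisation (1≤r , r≤ℓ , r≤c , c<)))))
          (sumFrom-𝟙-unique r (L r) (λ c → G (r , c)) (λ c → c ≡ᵇ end r) (end r) (addable r)
             (λ ad → m≤m+n r (a r) , +-monoʳ-< r (<ᵇ⇒< (a r) (L r) (T-∧-fst ad)))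
             (λ c t → ≡ᵇ⇒≡ c (end r) t) (λ _ → ≡⇒≡ᵇ (end r) (end r) refl))

  rowSum-T⁻ : ∀ {r} → 1 ≤ r → r ≤ ℓ lam → (F G : Box → Bool) →
              (∀ c → F (r , c) ≡ G (r , c) ∧ T⁻ᵇ lam ν (r , c)) →
              sumFrom (λ c → 𝟙 (F (r , c))) r (L r) ≡ 𝟙 (G (r , lastCol r) ∧ removable r)
  rowSum-T⁻ {r} 1≤r r≤ℓ F G F≡ =
    trans (sumFrom-cong r (L r) λ c r≤c c< →
             cong 𝟙 (trans (F≡ c) (cong (G (r , c) ∧_) (T⁻-characterisation (1≤r , r≤ℓ , r≤c , c<)))))
          (sumFrom-𝟙-unique r (L r) (λ c → G (r , c)) (λ c → suc c ≡ᵇ end r) (end r ∸ 1) (removable r)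
             inRow
             (λ c t → cong (_∸ 1) (≡ᵇ⇒≡ (suc c) (end r) t))
             (λ rm → ≡⇒≡ᵇ (suc (end r ∸ 1)) (end r) (lastCol+1 rm)))
    where
    lastCol+1 : T (removable r) → suc (end r ∸ 1) ≡ end r
    lastCol+1 rm = trans (+-comm 1 (end r ∸ 1)) (m∸n+n≡m (≤-trans (≤ᵇ⇒≤ 1 (a r) (T-∧-fst rm)) (m≤n+m (a r) r)))
    inRow : T (removable r) → r ≤ end r ∸ 1 × end r ∸ 1 < r + L r
    inRow rm = ℕ.s≤s⁻¹ (subst (suc r ≤_) (sym (lastCol+1 rm))
                 (subst (_≤ end r) (+-comm r 1) (+-monoʳ-≤ r (≤ᵇ⇒≤ 1 (a r) (T-∧-fst rm))))) ,
               <-≤-trans (subst (end r ∸ 1 <_) (lastCol+1 rm) ≤-refl) (+-monoʳ-≤ r (⊆lam r))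
-- Telescoping over consecutive rows

data RowPair (x y : ℕ) : Set where
  both-empty : x ≡ 0 → y ≡ 0 → RowPair x y
  step       : x ≡ suc y → RowPair x y
  gap        : 2 + y ≤ x → RowPair x y

rowPair : ∀ x y → y ≡ 0 ⊎ y < x → RowPair x y
rowPair zero y (inj₁ y≡0) = both-empty refl y≡0
rowPair (suc zero) y (inj₁ refl) = step refl
rowPair (suc (suc x)) y (inj₁ refl) = gap (s≤s (s≤s z≤n))
rowPair x y (inj₂ y<x) with m≤n⇒m<n∨m≡n y<x
... | inj₁ y+1<x = gap y+1<x
... | inj₂ y+1≡x = step (sym y+1≡x)

-- With x = ν_r, y = ν_{r+1}, l = λ_{r+1}: [end r ≤ j] + nwAdd (r + 1) ≡ [end (r + 1) ≤ j] + nwRemove r.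
upperStepˡ : ℕ → ℕ → ℕ → ℕ → ℕ → ℕ
upperStepˡ r x y l j = 𝟙 (r + x ≤ᵇ j) + 𝟙 ((suc r + y ≤ᵇ j) ∧ ((y <ᵇ l) ∧ (suc (suc y) ≤ᵇ x)))

upperStepʳ : ℕ → ℕ → ℕ → ℕ → ℕ
upperStepʳ r x y j =
  𝟙 (suc r + y ≤ᵇ j) + 𝟙 (((r + x ∸ 1 <ᵇ j) ∧ (r <ᵇ r + x ∸ 1)) ∧ ((1 ≤ᵇ x) ∧ ((x ≡ᵇ 1) ∨ not (suc y ≡ᵇ x))))

upperStep-step : ∀ r y l j → upperStepˡ r (suc y) y l j ≡ upperStepʳ r (suc y) y j
upperStep-step r zero l j
  rewrite +-suc r 0 | +-identityʳ r | <ᵇ-false (<-irrefl {r} refl) | ∧-zeroʳ (r <ᵇ j)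
        | ∧-zeroʳ (0 <ᵇ l) | ∧-zeroʳ (r <ᵇ j) = refl
upperStep-step r (suc y) l j
  rewrite +-suc r (suc y) | ≡ᵇ-true {y} refl | <ᵇ-false (<-irrefl {y} refl) =
  cong (𝟙 (r + suc y <ᵇ j) +_) (trans (𝟙-∧∧false (r + suc y <ᵇ j) (suc y <ᵇ l))
                                      (sym (𝟙-∧false ((r + suc y <ᵇ j) ∧ (r <ᵇ r + suc y)))))

upperStep-gap : ∀ r x y l j → 2 + y ≤ x → j < suc r + l → upperStepˡ r x y l j ≡ upperStepʳ r x y j
upperStep-gap r (suc zero) y l j (s≤s ()) _
upperStep-gap r (suc (suc x)) y l j y+2≤x j<
  rewrite +-suc r (suc x) | <ᵇ-true (m<m+n r {suc x} (s≤s z≤n))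
        | ≡ᵇ-false {y} {suc x} (λ eq → 1+n≰n (subst (_≤ x) eq (ℕ.s≤s⁻¹ (ℕ.s≤s⁻¹ y+2≤x))))
        | ≤ᵇ-true y+2≤x
  with suc r + y ≤? j
... | yes end≤j rewrite ≤ᵇ-true end≤j | <ᵇ-true (+-cancelˡ-< (suc r) y l (≤-<-trans end≤j j<))
  with r + suc x <ᵇ j
...   | true = refl
...   | false = refl
upperStep-gap r (suc (suc x)) y l j y+2≤x j< | no end≰j rewrite ≤ᵇ-false end≰j with r + suc x <ᵇ j
...   | true = refl
...   | false = refl

upperStep : ∀ r x y l j → y ≡ 0 ⊎ y < x → suc r ≤ j → j < suc r + l → upperStepˡ r x y l j ≡ upperStepʳ r x y j
upperStep r x y l j y<x r<j j< with rowPair x y y<x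
... | both-empty refl refl
  rewrite +-identityʳ r | ≤ᵇ-true (≤-trans (n≤1+n r) r<j) | ≤ᵇ-true r<j
        | 𝟙-∧false (0 <ᵇ l) | 𝟙-∧false ((r ∸ 1 <ᵇ j) ∧ (r <ᵇ r ∸ 1)) = refl
... | step refl = upperStep-step r y l j
... | gap y+2≤x = upperStep-gap r x y l j y+2≤x j<

-- With x = ν_k, y = ν_{k+1}, l = λ_k, l′ = λ_{k+1}: seRemove k + reaches (k + 1) ≡ reaches k + seCorner k + seAdd (k + 1).
lowerStepˡ : ℕ → ℕ → ℕ → ℕ → ℕ
lowerStepˡ k x y j =
  𝟙 ((j ≤ᵇ k + x ∸ 1) ∧ ((1 ≤ᵇ x) ∧ ((x ≡ᵇ 1) ∨ not (suc y ≡ᵇ x)))) + 𝟙 ((1 ≤ᵇ y) ∧ (j <ᵇ suc k + y))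

lowerStepʳ : ℕ → ℕ → ℕ → ℕ → ℕ → ℕ → ℕ
lowerStepʳ k x y l l′ j =
  𝟙 ((1 ≤ᵇ x) ∧ (j <ᵇ k + x))
  + 𝟙 ((suc l′ <ᵇ l) ∧ ((j ≤ᵇ k + l′) ∧ ((y ≡ᵇ l′) ∧ (suc (suc l′) ≤ᵇ x))))
  + 𝟙 (((j <ᵇ suc k + y) ∧ (suc k <ᵇ suc k + y)) ∧ ((y <ᵇ l′) ∧ (suc (suc y) ≤ᵇ x)))

𝟙-∧∧∧false : ∀ a b c → 𝟙 (a ∧ (b ∧ (c ∧ false))) ≡ 0
𝟙-∧∧∧false a b c = trans (cong (λ z → 𝟙 (a ∧ (b ∧ z))) (∧-zeroʳ c)) (𝟙-∧∧false a b)

lowerStep-empty : ∀ k l l′ j → lowerStepˡ k 0 0 j ≡ lowerStepʳ k 0 0 l l′ j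
lowerStep-empty k l l′ j =
  trans (cong (_+ 0) (𝟙-∧false (j ≤ᵇ k + 0 ∸ 1)))
        (sym (cong₂ _+_ (𝟙-∧∧∧false (suc l′ <ᵇ l) (j ≤ᵇ k + l′) (0 ≡ᵇ l′))
                        (𝟙-∧∧false ((j <ᵇ suc k + 0) ∧ (suc k <ᵇ suc k + 0)) (0 <ᵇ l′))))

lowerStep-lastRow : ∀ k l l′ j → lowerStepˡ k 1 0 j ≡ lowerStepʳ k 1 0 l l′ j
lowerStep-lastRow k l l′ j rewrite +-comm k 1 | ≤ᵇ≡<ᵇ-suc j k with j <ᵇ suc k
... | true = sym (cong₂ _+_ (cong (1 +_) (𝟙-∧∧∧false (suc l′ <ᵇ l) (j ≤ᵇ k + l′) (0 ≡ᵇ l′)))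
                            (𝟙-∧∧false ((j <ᵇ suc (k + 0)) ∧ (suc k <ᵇ suc (k + 0))) (0 <ᵇ l′)))
... | false = sym (cong₂ _+_ (𝟙-∧∧∧false (suc l′ <ᵇ l) (j ≤ᵇ k + l′) (0 ≡ᵇ l′))
                             (𝟙-∧∧false ((j <ᵇ suc (k + 0)) ∧ (suc k <ᵇ suc (k + 0))) (0 <ᵇ l′)))

noCorner-afterStep : ∀ y l′ → ((suc y ≡ᵇ l′) ∧ (suc (suc l′) ≤ᵇ suc (suc y))) ≡ false
noCorner-afterStep y l′ = ¬T⇒≡false λ t →
  1+n≰n (ℕ.s≤s⁻¹ (subst (λ z → suc (suc z) ≤ suc (suc y)) (sym (≡ᵇ⇒≡ (suc y) l′ (T-∧-fst t)))
                        (≤ᵇ⇒≤ (suc (suc l′)) (suc (suc y)) (T-∧-snd {suc y ≡ᵇ l′} t))))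

lowerStep-step : ∀ k y l l′ j → lowerStepˡ k (suc (suc y)) (suc y) j ≡ lowerStepʳ k (suc (suc y)) (suc y) l l′ j
lowerStep-step k y l l′ j
  rewrite ≡ᵇ-true {y} {y} refl | <ᵇ-false (<-irrefl {y} refl) | +-suc k (suc y) | 𝟙-∧false (j ≤ᵇ k + suc y) =
  sym (trans (cong₂ _+_ (cong (𝟙 (j <ᵇ suc (k + suc y)) +_)
                              (trans (cong (λ z → 𝟙 ((suc l′ <ᵇ l) ∧ ((j ≤ᵇ k + l′) ∧ z))) (noCorner-afterStep y l′))
                                     (𝟙-∧∧false (suc l′ <ᵇ l) (j ≤ᵇ k + l′))))
                        (𝟙-∧∧false ((j <ᵇ suc (k + suc y)) ∧ (k <ᵇ k + suc y)) (suc y <ᵇ l′)))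
             (trans (+-identityʳ _) (+-identityʳ _)))

lowerStep-gap-rows : ∀ b k y j → 𝟙 (b ∧ true) + 𝟙 ((0 <ᵇ y) ∧ (j <ᵇ suc (k + y))) ≡
                                 𝟙 b + 0 + 𝟙 (((j <ᵇ suc (k + y)) ∧ (k <ᵇ k + y)) ∧ true)
lowerStep-gap-rows true k zero j rewrite +-identityʳ k | <ᵇ-false (<-irrefl {k} refl) | ∧-zeroʳ (j <ᵇ suc k) = refl
lowerStep-gap-rows false k zero j rewrite +-identityʳ k | <ᵇ-false (<-irrefl {k} refl) | ∧-zeroʳ (j <ᵇ suc k) = refl
lowerStep-gap-rows b k (suc y) j rewrite <ᵇ-true (m<m+n k {suc y} (s≤s z≤n)) with b | j <ᵇ suc (k + suc y)
... | true | true = refl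
... | true | false = refl
... | false | true = refl
... | false | false = refl

lowerStep-gap : ∀ k x y l l′ j → 2 + y ≤ 2 + x → y < l′ →
                lowerStepˡ k (suc (suc x)) y j ≡ lowerStepʳ k (suc (suc x)) y l l′ j
lowerStep-gap k x y l l′ j y+2≤x+2 y<l′
  rewrite ≡ᵇ-false {y} {suc x} (λ eq → 1+n≰n (subst (_≤ x) eq (ℕ.s≤s⁻¹ (ℕ.s≤s⁻¹ y+2≤x+2))))
        | +-suc k (suc x) | ≤ᵇ≡<ᵇ-suc j (k + suc x)
        | ≤ᵇ-true y+2≤x+2 | ≡ᵇ-false (<⇒≢ y<l′) | <ᵇ-true y<l′
        | 𝟙-∧∧false (suc l′ <ᵇ l) (j ≤ᵇ k + l′)
  = lowerStep-gap-rows (j <ᵇ suc (k + suc x)) k y j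

lowerStep-corner : ∀ k x l l′ j → 2 + l′ ≤ 2 + x → 2 + x ≤ l → 1 ≤ l′ →
                   lowerStepˡ k (suc (suc x)) l′ j ≡ lowerStepʳ k (suc (suc x)) l′ l l′ j
lowerStep-corner k x l l′ j y+2≤x+2 x+2≤l 1≤l′
  rewrite ≡ᵇ-false {l′} {suc x} (λ eq → 1+n≰n (subst (_≤ x) eq (ℕ.s≤s⁻¹ (ℕ.s≤s⁻¹ y+2≤x+2))))
        | +-suc k (suc x) | ≤ᵇ≡<ᵇ-suc j (k + suc x)
        | ≤ᵇ-true y+2≤x+2 | ≡ᵇ-true {l′} refl | <ᵇ-false (<-irrefl {l′} refl)
        | <ᵇ-true (≤-trans y+2≤x+2 x+2≤l) | ≤ᵇ-true 1≤l′ | ≤ᵇ≡<ᵇ-suc j (k + l′)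
        | 𝟙-∧false ((j <ᵇ suc (k + l′)) ∧ (k <ᵇ k + l′))
  with j <ᵇ suc (k + suc x) | j <ᵇ suc (k + l′)
... | true | true = refl
... | true | false = refl
... | false | true = refl
... | false | false = refl

lowerStep : ∀ k x y l l′ j → y ≡ 0 ⊎ y < x → y ≤ l′ → x ≤ l → 1 ≤ l′ →
            lowerStepˡ k x y j ≡ lowerStepʳ k x y l l′ j
lowerStep k x y l l′ j y<x y≤l′ x≤l 1≤l′ with rowPair x y y<x
lowerStep k _ _ l l′ j _ _ _ _ | both-empty refl refl = lowerStep-empty k l l′ j
lowerStep k _ zero l l′ j _ _ _ _ | step refl = lowerStep-lastRow k l l′ j
lowerStep k _ (suc y) l l′ j _ _ _ _ | step refl = lowerStep-step k y l l′ j
lowerStep k (suc (suc x)) y l l′ j _ y≤l′ x≤l 1≤l′ | gap y+2≤x+2 with m≤n⇒m<n∨m≡n y≤l′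
... | inj₁ y<l′ = lowerStep-gap k x y l l′ j y+2≤x+2 y<l′
... | inj₂ refl = lowerStep-corner k x l y j y+2≤x+2 x≤l 1≤l′
lowerStep k (suc zero) _ _ _ _ _ _ _ _ | gap (s≤s ())

lowerStep-last : ∀ k x j → 𝟙 ((j ≤ᵇ k + x ∸ 1) ∧ ((1 ≤ᵇ x) ∧ ((x ≡ᵇ 1) ∨ not (1 ≡ᵇ x)))) ≡ 𝟙 ((1 ≤ᵇ x) ∧ (j <ᵇ k + x))
lowerStep-last k zero j = 𝟙-∧false _
lowerStep-last k (suc zero) j
  rewrite +-suc k 0 | +-identityʳ k | ≤ᵇ≡<ᵇ-suc j k | ∧-identityʳ (j <ᵇ suc k) = refl
lowerStep-last k (suc (suc x)) j
  rewrite +-suc k (suc x) | ≤ᵇ≡<ᵇ-suc j (k + suc x) | ∧-identityʳ (j <ᵇ suc (k + suc x)) = refl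

upper-rearrange : ∀ p C q r w → p + q ≡ r + w → (p + C) + q ≡ r + (C + w)
upper-rearrange p C q r w h = begin
  (p + C) + q ≡⟨ solve 3 (λ p C q → (p :+ C) :+ q := (p :+ q) :+ C) refl p C q ⟩
  (p + q) + C ≡⟨ cong (_+ C) h ⟩
  (r + w) + C ≡⟨ solve 3 (λ r w C → (r :+ w) :+ C := r :+ (C :+ w)) refl r w C ⟩
  r + (C + w) ∎
  where open ≡-Reasoning
        open +-*-Solver

lower-rearrange : ∀ b i' k' d' i uk ud → b + i' ≡ i + uk + ud → b + (i' + k' + d') ≡ i + (uk + k') + (ud + d')
lower-rearrange b i' k' d' i uk ud h = begin
  b + (i' + k' + d')        ≡⟨ solve 4 (λ b i' k' d' → b :+ (i' :+ k' :+ d') := (b :+ i') :+ (k' :+ d')) refl b i' k' d' ⟩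
  (b + i') + (k' + d')      ≡⟨ cong (_+ (k' + d')) h ⟩
  (i + uk + ud) + (k' + d') ≡⟨ solve 5 (λ i uk ud k' d' → (i :+ uk :+ ud) :+ (k' :+ d') := i :+ (uk :+ k') :+ (ud :+ d')) refl i uk ud k' d' ⟩
  i + (uk + k') + (ud + d') ∎
  where open ≡-Reasoning
        open +-*-Solver

module Telescopes (lam ν : List ℕ) (sl : Strict lam) (ν-ideal : ShiftedIdeal lam ν) (j : ℕ) where

  open ShiftedIdeal ν-ideal
  open Toggles lam ν sl ν-ideal

  nwAdd nwRemove seRemove seAdd seCorner reaches : ℕ → ℕ
  nwAdd r = 𝟙 ((end r ≤ᵇ j) ∧ addable r)
  nwRemove r = 𝟙 (((lastCol r <ᵇ j) ∧ (r <ᵇ lastCol r)) ∧ removable r)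
  seRemove r = 𝟙 ((j ≤ᵇ lastCol r) ∧ removable r)
  seAdd r = 𝟙 (((j <ᵇ end r) ∧ (r <ᵇ end r)) ∧ addable r)
  seCorner m = 𝟙 ((suc (L (suc m)) <ᵇ L m) ∧ ((j ≤ᵇ m + L (suc m)) ∧ cornerInᵇ lam m ν))
  reaches r = 𝟙 ((1 ≤ᵇ a r) ∧ (j <ᵇ end r))

  upperTelescope : ∀ k → 1 ≤ k → k ≤ ℓ lam → k ≤ j → j < k + L k →
                   sumFrom nwAdd 1 k ≡ 𝟙 (end k ≤ᵇ j) + sumFrom nwRemove 1 (k ∸ 1)
  upperTelescope (suc zero) _ _ _ j< with 1 + a 1 ≤? j
  ... | yes end≤j rewrite ≤ᵇ-true end≤j | <ᵇ-true (+-cancelˡ-< 1 (a 1) (L 1) (≤-<-trans end≤j j<)) = refl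
  ... | no end≰j rewrite ≤ᵇ-false end≰j = refl
  upperTelescope (suc (suc k)) _ k+2≤ℓ k+2≤j j< = begin
    sumFrom nwAdd 1 (suc (suc k))
      ≡⟨ sumFrom-snoc nwAdd 1 (suc k) ⟩
    sumFrom nwAdd 1 (suc k) + nwAdd (suc (suc k))
      ≡⟨ cong (_+ nwAdd (suc (suc k)))
              (upperTelescope (suc k) (s≤s z≤n) (≤-trans (n≤1+n _) k+2≤ℓ) (≤-trans (n≤1+n _) k+2≤j) j<′) ⟩
    𝟙 (end (suc k) ≤ᵇ j) + sumFrom nwRemove 1 k + nwAdd (suc (suc k))
      ≡⟨ upper-rearrange (𝟙 (end (suc k) ≤ᵇ j)) (sumFrom nwRemove 1 k) (nwAdd (suc (suc k)))
                         (𝟙 (end (suc (suc k)) ≤ᵇ j)) (nwRemove (suc k))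
           (upperStep (suc k) (a (suc k)) (a (suc (suc k))) (L (suc (suc k))) j
                      (decreasing (suc k) (s≤s z≤n)) k+2≤j j<) ⟩
    𝟙 (end (suc (suc k)) ≤ᵇ j) + (sumFrom nwRemove 1 k + nwRemove (suc k))
      ≡⟨ cong (𝟙 (end (suc (suc k)) ≤ᵇ j) +_) (sym (sumFrom-snoc nwRemove 1 k)) ⟩
    𝟙 (end (suc (suc k)) ≤ᵇ j) + sumFrom nwRemove 1 (suc k) ∎
    where
    open ≡-Reasoning
    j<′ : j < suc k + L (suc k)
    j<′ = <-≤-trans j< (subst (_≤ suc k + L (suc k)) (+-suc (suc k) (L (suc (suc k))))
                              (+-monoʳ-≤ (suc k) (part-decreasing sl (suc k) (s≤s z≤n) k+2≤ℓ)))

  lowerTelescope : ∀ n k → k + n ≡ ℓ lam → 1 ≤ k →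
                   sumFrom seRemove k (suc n) ≡ reaches k + sumFrom seCorner k n + sumFrom seAdd (suc k) n
  lowerTelescope zero k k≡ℓ _ = begin
    seRemove k + 0
      ≡⟨ +-identityʳ _ ⟩
    𝟙 ((j ≤ᵇ lastCol k) ∧ ((1 ≤ᵇ a k) ∧ ((a k ≡ᵇ 1) ∨ not (suc (a (suc k)) ≡ᵇ a k))))
      ≡⟨ cong (λ y → 𝟙 ((j ≤ᵇ lastCol k) ∧ ((1 ≤ᵇ a k) ∧ ((a k ≡ᵇ 1) ∨ not (suc y ≡ᵇ a k))))) ak+1≡0 ⟩
    𝟙 ((j ≤ᵇ lastCol k) ∧ ((1 ≤ᵇ a k) ∧ ((a k ≡ᵇ 1) ∨ not (1 ≡ᵇ a k))))
      ≡⟨ lowerStep-last k (a k) j ⟩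
    reaches k
      ≡⟨ +-identityʳ _ ⟨
    reaches k + 0
      ≡⟨ +-identityʳ _ ⟨
    reaches k + 0 + 0 ∎
    where
    open ≡-Reasoning
    ak+1≡0 : a (suc k) ≡ 0
    ak+1≡0 = n≤0⇒n≡0 (≤-trans (⊆lam (suc k))
               (≤-reflexive (part-beyond-length lam (suc k) (≤-reflexive (cong suc (trans (sym k≡ℓ) (+-identityʳ k)))))))
  lowerTelescope (suc n) (suc k₀) k≡ℓ _ =
    trans (cong (seRemove k +_) (lowerTelescope n (suc k) (trans (sym (+-suc k n)) k≡ℓ) (s≤s z≤n)))
      (lower-rearrange (seRemove k) (reaches (suc k)) (sumFrom seCorner (suc k) n) (sumFrom seAdd (suc (suc k)) n)
                       (reaches k) (seCorner k) (seAdd (suc k))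
        (lowerStep k (a k) (a (suc k)) (L k) (L (suc k)) j (decreasing k (s≤s z≤n)) (⊆lam (suc k)) (⊆lam k)
           (part-positive sl (suc k) (s≤s z≤n) (subst (suc k ≤_) k≡ℓ (subst (_≤ k + suc n) (+-comm k 1) (+-monoʳ-≤ k (s≤s z≤n)))))))
    where k = suc k₀

-- The pointwise identity and the expectation

module Pointwise (lam ν : List ℕ) (sl : Strict lam) (ν-ideal : ShiftedIdeal lam ν)
                 (i j : ℕ) (box : IsBox lam i j) where

  open Toggles lam ν sl ν-ideal
  open Telescopes lam ν sl ν-ideal j

  1≤i : 1 ≤ i
  1≤i = proj₁ box

  i≤ℓ : i ≤ ℓ lam
  i≤ℓ = proj₁ (proj₂ box)

  ℓ≡i+ : ℓ lam ≡ i + (ℓ lam ∸ i)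
  ℓ≡i+ = sym (m+[n∸m]≡n i≤ℓ)

  i-1+1≡i : 1 + (i ∸ 1) ≡ i
  i-1+1≡i = m+[n∸m]≡n 1≤i

  ℓ≡i-1+ : ℓ lam ≡ (i ∸ 1) + suc (ℓ lam ∸ i)
  ℓ≡i-1+ = trans ℓ≡i+ (trans (cong (_+ (ℓ lam ∸ i)) (sym i-1+1≡i)) (sym (+-suc (i ∸ 1) (ℓ lam ∸ i))))

  rowSums : ∀ F v → (∀ r → 1 ≤ r → r ≤ ℓ lam → sumFrom (λ c → 𝟙 (F (r , c))) r (L r) ≡ v r) →
            count (boxes lam) F ≡ sumFrom v 1 (ℓ lam)
  rowSums F v rows = trans (count-boxes lam F) (sumFrom-cong 1 (ℓ lam) λ r 1≤r r< → rows r 1≤r (ℕ.s≤s⁻¹ r<))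

  nw⁺ nw⁻ se⁺ se⁻ : Box → Bool
  nw⁺ p = (proj₁ p ≤ᵇ i) ∧ (proj₂ p ≤ᵇ j)
  se⁻ p = (i ≤ᵇ proj₁ p) ∧ (j ≤ᵇ proj₂ p)
  nw⁻ p = (proj₁ p <ᵇ i) ∧ (proj₂ p <ᵇ j) ∧ (proj₁ p <ᵇ proj₂ p)
  se⁺ p = (i <ᵇ proj₁ p) ∧ (j <ᵇ proj₂ p) ∧ (proj₁ p <ᵇ proj₂ p)

  nw-T⁺ se-T⁻ nw-T⁻ se-T⁺ : Box → Bool
  nw-T⁺ p = (proj₁ p ≤ᵇ i) ∧ (proj₂ p ≤ᵇ j) ∧ T⁺ᵇ lam ν p
  se-T⁻ p = (i ≤ᵇ proj₁ p) ∧ (j ≤ᵇ proj₂ p) ∧ T⁻ᵇ lam ν p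
  nw-T⁻ p = (proj₁ p <ᵇ i) ∧ (proj₂ p <ᵇ j) ∧ (proj₁ p <ᵇ proj₂ p) ∧ T⁻ᵇ lam ν p
  se-T⁺ p = (i <ᵇ proj₁ p) ∧ (j <ᵇ proj₂ p) ∧ (proj₁ p <ᵇ proj₂ p) ∧ T⁺ᵇ lam ν p

  ∧-assoc₄ : ∀ x y z w → x ∧ y ∧ z ∧ w ≡ (x ∧ y ∧ z) ∧ w
  ∧-assoc₄ x y z w = sym (trans (∧-assoc x (y ∧ z) w) (cong (x ∧_) (∧-assoc y z w)))

  count-nw⁺ : count (boxes lam) nw-T⁺ ≡ sumFrom nwAdd 1 i
  count-nw⁺ = trans (rowSums nw-T⁺ _ λ r 1≤r r≤ℓ → rowSum-T⁺ 1≤r r≤ℓ nw-T⁺ nw⁺ λ c → sym (∧-assoc (r ≤ᵇ i) (c ≤ᵇ j) _))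
              (trans (cong (sumFrom _ 1) ℓ≡i+) (sumFrom-prefix 1 i (ℓ lam ∸ i) inside outside))
    where
    inside : ∀ r → 1 ≤ r → r < 1 + i → 𝟙 (nw⁺ (r , end r) ∧ addable r) ≡ nwAdd r
    inside r _ r< rewrite ≤ᵇ-true (ℕ.s≤s⁻¹ r<) = refl
    outside : ∀ r → 1 + i ≤ r → r < 1 + i + (ℓ lam ∸ i) → 𝟙 (nw⁺ (r , end r) ∧ addable r) ≡ 0
    outside r i< _ rewrite ≤ᵇ-false {r} {i} (<⇒≱ i<) = refl

  count-nw⁻ : count (boxes lam) nw-T⁻ ≡ sumFrom nwRemove 1 (i ∸ 1)
  count-nw⁻ = trans (rowSums nw-T⁻ _ λ r 1≤r r≤ℓ → rowSum-T⁻ 1≤r r≤ℓ nw-T⁻ nw⁻ λ c → ∧-assoc₄ (r <ᵇ i) (c <ᵇ j) (r <ᵇ c) _)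
              (trans (cong (sumFrom _ 1) ℓ≡i-1+) (sumFrom-prefix 1 (i ∸ 1) (suc (ℓ lam ∸ i)) inside outside))
    where
    inside : ∀ r → 1 ≤ r → r < 1 + (i ∸ 1) → 𝟙 (nw⁻ (r , lastCol r) ∧ removable r) ≡ nwRemove r
    inside r _ r< rewrite <ᵇ-true {r} {i} (<-≤-trans r< (≤-reflexive i-1+1≡i)) = refl
    outside : ∀ r → 1 + (i ∸ 1) ≤ r → r < 1 + (i ∸ 1) + suc (ℓ lam ∸ i) → 𝟙 (nw⁻ (r , lastCol r) ∧ removable r) ≡ 0
    outside r i≤ _ rewrite <ᵇ-false {r} {i} (≤⇒≯ (subst (_≤ r) i-1+1≡i i≤)) = refl

  count-se⁻ : count (boxes lam) se-T⁻ ≡ sumFrom seRemove i (suc (ℓ lam ∸ i))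
  count-se⁻ = trans (rowSums se-T⁻ _ λ r 1≤r r≤ℓ → rowSum-T⁻ 1≤r r≤ℓ se-T⁻ se⁻ λ c → sym (∧-assoc (i ≤ᵇ r) (j ≤ᵇ c) _))
              (trans (cong (sumFrom _ 1) ℓ≡i-1+) (sumFrom-suffix 1 (i ∸ 1) (suc (ℓ lam ∸ i)) i i-1+1≡i outside inside))
    where
    outside : ∀ r → 1 ≤ r → r < 1 + (i ∸ 1) → 𝟙 (se⁻ (r , lastCol r) ∧ removable r) ≡ 0
    outside r _ r< rewrite ≤ᵇ-false {i} {r} (<⇒≱ (<-≤-trans r< (≤-reflexive i-1+1≡i))) = refl
    inside : ∀ r → i ≤ r → r < i + suc (ℓ lam ∸ i) → 𝟙 (se⁻ (r , lastCol r) ∧ removable r) ≡ seRemove r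
    inside r i≤ _ rewrite ≤ᵇ-true i≤ = refl

  count-se⁺ : count (boxes lam) se-T⁺ ≡ sumFrom seAdd (suc i) (ℓ lam ∸ i)
  count-se⁺ = trans (rowSums se-T⁺ _ λ r 1≤r r≤ℓ → rowSum-T⁺ 1≤r r≤ℓ se-T⁺ se⁺ λ c → ∧-assoc₄ (i <ᵇ r) (j <ᵇ c) (r <ᵇ c) _)
              (trans (cong (sumFrom _ 1) ℓ≡i+) (sumFrom-suffix 1 i (ℓ lam ∸ i) (suc i) refl outside inside))
    where
    outside : ∀ r → 1 ≤ r → r < 1 + i → 𝟙 (se⁺ (r , end r) ∧ addable r) ≡ 0
    outside r _ r< rewrite <ᵇ-false {i} {r} (≤⇒≯ (ℕ.s≤s⁻¹ r<)) = refl
    inside : ∀ r → suc i ≤ r → r < suc i + (ℓ lam ∸ i) → 𝟙 (se⁺ (r , end r) ∧ addable r) ≡ seAdd r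
    inside r i< _ rewrite <ᵇ-true i< = refl

  count-corners : countᵇ (cornersSE lam i j) (λ m → cornerInᵇ lam m ν) ≡ sumFrom seCorner i (ℓ lam ∸ i)
  count-corners = begin
    countᵇ (cornersSE lam i j) (λ m → cornerInᵇ lam m ν)
      ≡⟨ countᵇ-filter _ _ (corners lam) ⟩
    countᵇ (corners lam) (λ m → seᵇ m ∧ cornerInᵇ lam m ν)
      ≡⟨ countᵇ-filter _ _ (range 1 (ℓ lam ∸ 1)) ⟩
    countᵇ (range 1 (ℓ lam ∸ 1)) (λ m → isCorner m ∧ (seᵇ m ∧ cornerInᵇ lam m ν))
      ≡⟨ countᵇ-interval _ 1 (ℓ lam ∸ 1) ⟩
    sumFrom (λ m → 𝟙 (isCorner m ∧ (seᵇ m ∧ cornerInᵇ lam m ν))) 1 (ℓ lam ∸ 1)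
      ≡⟨ cong (sumFrom _ 1) (trans (cong (_∸ 1) ℓ≡i+) (+-∸-comm (ℓ lam ∸ i) 1≤i)) ⟩
    sumFrom (λ m → 𝟙 (isCorner m ∧ (seᵇ m ∧ cornerInᵇ lam m ν))) 1 ((i ∸ 1) + (ℓ lam ∸ i))
      ≡⟨ sumFrom-suffix 1 (i ∸ 1) (ℓ lam ∸ i) i i-1+1≡i outside inside ⟩
    sumFrom seCorner i (ℓ lam ∸ i) ∎
    where
    open ≡-Reasoning
    isCorner seᵇ : ℕ → Bool
    isCorner m = suc (part lam (suc m)) <ᵇ part lam m
    seᵇ m = (i ≤ᵇ m) ∧ (j ≤ᵇ m + part lam (suc m))
    outside : ∀ m → 1 ≤ m → m < 1 + (i ∸ 1) → 𝟙 (isCorner m ∧ (seᵇ m ∧ cornerInᵇ lam m ν)) ≡ 0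
    outside m _ m< rewrite ≤ᵇ-false {i} {m} (<⇒≱ (<-≤-trans m< (≤-reflexive i-1+1≡i))) = 𝟙-∧false (isCorner m)
    inside : ∀ m → i ≤ m → m < i + (ℓ lam ∸ i) → 𝟙 (isCorner m ∧ (seᵇ m ∧ cornerInᵇ lam m ν)) ≡ seCorner m
    inside m i≤ _ rewrite ≤ᵇ-true i≤ = refl

  j<end⇒1≤a : j < end i → 1 ≤ a i
  j<end⇒1≤a j<end = +-cancelˡ-≤ i 1 (a i) (subst (_≤ end i) (+-comm 1 i) (<-≤-trans (s≤s (proj₁ (proj₂ (proj₂ box)))) j<end))

  endOrReaches : 𝟙 (end i ≤ᵇ j) + reaches i ≡ 1
  endOrReaches with end i ≤? j
  ... | yes end≤j rewrite ≤ᵇ-true end≤j | <ᵇ-false (≤⇒≯ end≤j) = cong suc (𝟙-∧false (1 ≤ᵇ a i))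
  ... | no end≰j rewrite ≤ᵇ-false end≰j | <ᵇ-true (≰⇒> end≰j) | ≤ᵇ-true (j<end⇒1≤a (≰⇒> end≰j)) = refl

  private
    cong₄ : ∀ (f : ℕ → ℕ → ℕ → ℕ → ℤ) {a b c d a' b' c' d'} →
            a ≡ a' → b ≡ b' → c ≡ c' → d ≡ d' → f a b c d ≡ f a' b' c' d'
    cong₄ f refl refl refl refl = refl

    cancel : ∀ u v C K D → ⁺ (u + C) ℤ.+ ⁺ (v + K + D) ℤ.- ⁺ C ℤ.- ⁺ D ≡ ⁺ (u + v + K)
    cancel u v C K D =
      solve 5 (λ u v C K D → ((u :+ C) :+ (v :+ K :+ D)) :- C :- D := u :+ v :+ K) refl (⁺ u) (⁺ v) (⁺ C) (⁺ K) (⁺ D)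
      where open ℤ-Solver

  rook≡1+corners : Rshift lam i j ν ≡ ⁺ (1 + countᵇ (cornersSE lam i j) (λ m → cornerInᵇ lam m ν))
  rook≡1+corners = begin
    Rshift lam i j ν
      ≡⟨ cong₄ (λ a b c d → ⁺ a ℤ.+ ⁺ b ℤ.- ⁺ c ℤ.- ⁺ d)
               (trans count-nw⁺ (upperTelescope i 1≤i i≤ℓ i≤j j<))
               (trans count-se⁻ (lowerTelescope (ℓ lam ∸ i) i (sym ℓ≡i+) 1≤i))
               count-nw⁻ count-se⁺ ⟩
    ⁺ (𝟙 (end i ≤ᵇ j) + C) ℤ.+ ⁺ (reaches i + K + D) ℤ.- ⁺ C ℤ.- ⁺ D
      ≡⟨ cancel (𝟙 (end i ≤ᵇ j)) (reaches i) C K D ⟩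
    ⁺ (𝟙 (end i ≤ᵇ j) + reaches i + K)
      ≡⟨ cong (λ n → ⁺ (n + K)) endOrReaches ⟩
    ⁺ (1 + K)
      ≡⟨ cong (λ n → ⁺ (1 + n)) count-corners ⟨
    ⁺ (1 + countᵇ (cornersSE lam i j) (λ m → cornerInᵇ lam m ν)) ∎
    where
    open ≡-Reasoning
    i≤j = proj₁ (proj₂ (proj₂ box))
    j< = proj₂ (proj₂ (proj₂ box))
    C = sumFrom nwRemove 1 (i ∸ 1)
    K = sumFrom seCorner i (ℓ lam ∸ i)
    D = sumFrom seAdd (suc i) (ℓ lam ∸ i)

toℚ-ℕ : ∀ n → toℚ (⁺ n) ≡ mkℚ (⁺ n) 0 (coprime-sym (1-coprimeTo n))
toℚ-ℕ n = ℚ.normalize-coprime (coprime-sym (1-coprimeTo n))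

toℚ-suc : ∀ n → toℚ (⁺ suc n) ≡ 1ℚ ℚ.+ toℚ (⁺ n)
toℚ-suc n = trans (cong (ℚ._/ 1) (cong (λ z → ⁺ 1 ℤ.+ z) (sym (ℤ.*-identityʳ (⁺ n))))) (cong (1ℚ ℚ.+_) (sym (toℚ-ℕ n)))

Σℚ-cong : ∀ {A : Set} (xs : List A) {f g : A → ℚ} → (∀ x → x ∈ xs → f x ≡ g x) → Σℚ xs f ≡ Σℚ xs g
Σℚ-cong [] _ = refl
Σℚ-cong (x ∷ xs) f≡g = cong₂ ℚ._+_ (f≡g x (here refl)) (Σℚ-cong xs λ y y∈ → f≡g y (there y∈))

Σℚ-+ : ∀ {A : Set} (xs : List A) (f g : A → ℚ) → Σℚ xs (λ x → f x ℚ.+ g x) ≡ Σℚ xs f ℚ.+ Σℚ xs g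
Σℚ-+ [] f g = sym (ℚ.+-identityʳ 0ℚ)
Σℚ-+ (x ∷ xs) f g = trans (cong (f x ℚ.+ g x ℚ.+_) (Σℚ-+ xs f g)) (interchange (f x) (g x) (Σℚ xs f) (Σℚ xs g))
  where
  open import Algebra.Solver.CommutativeMonoid ℚ.+-0-commutativeMonoid using (solve; _⊕_; _⊜_)
  interchange : ∀ a b c d → (a ℚ.+ b) ℚ.+ (c ℚ.+ d) ≡ (a ℚ.+ c) ℚ.+ (b ℚ.+ d)
  interchange = solve 4 (λ a b c d → (a ⊕ b) ⊕ (c ⊕ d) ⊜ (a ⊕ c) ⊕ (b ⊕ d)) refl

Σℚ-1+countᵇ : ∀ {A B : Set} (xs : List A) (μ : A → ℚ) (g : B → A → Bool) (cs : List B) →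
  Σℚ xs (λ x → μ x ℚ.* toℚ (⁺ (1 + countᵇ cs (λ m → g m x)))) ≡
  Σℚ xs μ ℚ.+ Σℚ cs (λ m → Σℚ xs (λ x → if g m x then μ x else 0ℚ))
Σℚ-1+countᵇ xs μ g [] = trans (Σℚ-cong xs λ x _ → ℚ.*-identityʳ (μ x)) (sym (ℚ.+-identityʳ _))
Σℚ-1+countᵇ xs μ g (m ∷ cs) = begin
  Σℚ xs (λ x → μ x ℚ.* toℚ (⁺ (1 + (𝟙 (g m x) + countᵇ cs (λ m → g m x)))))
    ≡⟨ Σℚ-cong xs (λ x _ → split (μ x) (g m x) (countᵇ cs (λ m → g m x))) ⟩
  Σℚ xs (λ x → P m x ℚ.+ μ x ℚ.* toℚ (⁺ (1 + countᵇ cs (λ m → g m x))))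
    ≡⟨ Σℚ-+ xs (P m) _ ⟩
  Σℚ xs (P m) ℚ.+ Σℚ xs (λ x → μ x ℚ.* toℚ (⁺ (1 + countᵇ cs (λ m → g m x))))
    ≡⟨ cong (Σℚ xs (P m) ℚ.+_) (Σℚ-1+countᵇ xs μ g cs) ⟩
  Σℚ xs (P m) ℚ.+ (Σℚ xs μ ℚ.+ Σℚ cs (λ m → Σℚ xs (P m)))
    ≡⟨ swap (Σℚ xs (P m)) (Σℚ xs μ) _ ⟩
  Σℚ xs μ ℚ.+ (Σℚ xs (P m) ℚ.+ Σℚ cs (λ m → Σℚ xs (P m))) ∎
  where
  open ≡-Reasoning
  open import Algebra.Solver.CommutativeMonoid ℚ.+-0-commutativeMonoid using (solve; _⊕_; _⊜_)
  P : _ → _ → ℚ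
  P m x = if g m x then μ x else 0ℚ
  swap : ∀ a b c → a ℚ.+ (b ℚ.+ c) ≡ b ℚ.+ (a ℚ.+ c)
  swap = solve 3 (λ a b c → a ⊕ (b ⊕ c) ⊜ b ⊕ (a ⊕ c)) refl
  split : ∀ p b n → p ℚ.* toℚ (⁺ (1 + (𝟙 b + n))) ≡ (if b then p else 0ℚ) ℚ.+ p ℚ.* toℚ (⁺ (1 + n))
  split p true n = begin
    p ℚ.* toℚ (⁺ suc (suc n))                  ≡⟨ cong (p ℚ.*_) (toℚ-suc (suc n)) ⟩
    p ℚ.* (1ℚ ℚ.+ toℚ (⁺ suc n))               ≡⟨ ℚ.*-distribˡ-+ p 1ℚ _ ⟩
    p ℚ.* 1ℚ ℚ.+ p ℚ.* toℚ (⁺ suc n)           ≡⟨ cong (ℚ._+ p ℚ.* toℚ (⁺ suc n)) (ℚ.*-identityʳ p) ⟩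
    p ℚ.+ p ℚ.* toℚ (⁺ suc n)                  ∎
  split p false n = sym (ℚ.+-identityˡ _)

lemma4p4 : (lam : List ℕ) → Strict lam → (μ : List ℕ → ℚ) → IsDistribution lam μ →
    (i j : ℕ) → IsBox lam i j →
    𝔼 lam μ (Rshift lam i j) ≡ 1ℚ ℚ.+ Σℚ (cornersSE lam i j) (λ m → ℙ lam μ (cornerInᵇ lam m))
lemma4p4 lam sl μ (_ , Σμ≡1) i j box = begin
  𝔼 lam μ (Rshift lam i j)
    ≡⟨ Σℚ-cong (ideals lam) (λ ν ν∈ →
         cong (λ z → μ ν ℚ.* toℚ z) (Pointwise.rook≡1+corners lam ν sl (ideals⇒ShiftedIdeal ν∈) i j box)) ⟩
  Σℚ (ideals lam) (λ ν → μ ν ℚ.* toℚ (⁺ (1 + countᵇ (cornersSE lam i j) (λ m → cornerInᵇ lam m ν))))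
    ≡⟨ Σℚ-1+countᵇ (ideals lam) μ (cornerInᵇ lam) (cornersSE lam i j) ⟩
  Σℚ (ideals lam) μ ℚ.+ Σℚ (cornersSE lam i j) (λ m → ℙ lam μ (cornerInᵇ lam m))
    ≡⟨ cong (ℚ._+ Σℚ (cornersSE lam i j) (λ m → ℙ lam μ (cornerInᵇ lam m))) Σμ≡1 ⟩
  1ℚ ℚ.+ Σℚ (cornersSE lam i j) (λ m → ℙ lam μ (cornerInᵇ lam m)) ∎
  where open ≡-Reasoning
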